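{- Let $e_n(y)=\sum_{\pi\in\mathcal{D}_{23\text{ - }1}(n)}y^{\mu(\pi)}$ for $n\ge2$ and $E(x,y)=\sum_{n\ge2}e_n(y)\frac{x^n}{n!}$. Then $$\frac{\partial^2}{\partial x^2}E(x,y)=ye^x\big(1+E(x,y)\big)+\big((y+1)e^x-y\big)\frac{\partial}{\partial x}E(x,y).$$
   Context: Every permutation $\pi$ of $[n]=\{1,\dots,n\}$ is written in standard cycle form: each cycle is written starting with its smallest element, and the cycles are ordered from left to right by increasing first elements. The flattened form $\mathrm{flat}(\pi)$ is the word (in one-line notation) obtained by erasing the parentheses of the standard cycle form. A derangement is a permutation with no fixed points; $\mathcal{D}(n)$ is the set of derangements of $[n]$, and $\mu(\pi)$ denotes the number of cycles of $\pi$. A word $w=w_1\cdots w_n$ of distinct integers contains the vincular pattern $23\text{ - }1$ if there are indices $i$ and $k>i+1$ with $w_k<w_i<w_{i+1}$, and avoids it otherwise. $\mathcal{D}_{23\text{ - }1}(n)$ is the set of $\pi\in\mathcal{D}(n)$ such that $\mathrm{flat}(\pi)$ avoids $23\text{ - }1$. The identity is of formal power series in $x$. -}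

module Defs where

open import Data.Bool using (Bool; true; false; _∧_; _∨_; not; if_then_else_)
open import Data.Nat using (ℕ; zero; suc; _+_; _∸_; _<ᵇ_; _≡ᵇ_; _!)
open import Data.Nat.Properties using (_!≢0)
open import Data.Fin using (Fin; toℕ)
open import Data.Vec using (Vec; []; _∷_; lookup)
open import Data.List using (List; []; _∷_; _++_; map; concat; concatMap; length; filterᵇ; allFin)
open import Data.Bool.ListAction using (any; all)
open import Data.Integer using (+_)
open import Data.Rational using (ℚ; 0ℚ; 1ℚ; _/_) renaming (_+_ to _+ℚ_; _*_ to _*ℚ_; _-_ to _-ℚ_)

-- Permutations of [n] (encoded 0-based as Fin n), as their one-line
-- vector of values.  All maps [n] → [n] are enumerated explicitly.

allMaps : (k m : ℕ) → List (Vec (Fin m) k)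
allMaps zero    m = [] ∷ []
allMaps (suc k) m = concatMap (λ x → map (x ∷_) (allMaps k m)) (allFin m)

_==F_ : ∀ {n} → Fin n → Fin n → Bool
i ==F j = toℕ i ≡ᵇ toℕ j

elemF : ∀ {n} → Fin n → List (Fin n) → Bool
elemF i xs = any (i ==F_) xs

distinct : ∀ {n} → List (Fin n) → Bool
distinct []       = true
distinct (x ∷ xs) = not (elemF x xs) ∧ distinct xs

isPermutation : ∀ {n} → Vec (Fin n) n → Bool
isPermutation {n} v = distinct (map (lookup v) (allFin n))

isDerangement : ∀ {n} → Vec (Fin n) n → Bool
isDerangement {n} v = isPermutation v ∧ all (λ i → not (lookup v i ==F i)) (allFin n)

trace : ∀ {n} → ℕ → Vec (Fin n) n → Fin n → Fin n → List (Fin n)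
trace zero    π s c = []
trace (suc f) π s c = if c ==F s then [] else c ∷ trace f π s (lookup π c)

cycleOf : ∀ {n} → Vec (Fin n) n → Fin n → List (Fin n)
cycleOf {n} π i = i ∷ trace n π i (lookup π i)

-- Scanning the elements in increasing order, each not-yet-visited element
-- is the smallest element of its cycle; cycles are listed by increasing
-- first (= smallest) element.
cyclesFrom : ∀ {n} → Vec (Fin n) n → List (Fin n) → List (Fin n) → List (List (Fin n))
cyclesFrom π []       vis = []
cyclesFrom π (i ∷ is) vis =
  if elemF i vis then cyclesFrom π is vis
  else cycleOf π i ∷ cyclesFrom π is (cycleOf π i ++ vis)

standardCycleForm : ∀ {n} → Vec (Fin n) n → List (List (Fin n))
standardCycleForm {n} π = cyclesFrom π (allFin n) []

-- flat(π), as a word of natural numbers (0-based labels; order-isomorphic)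
flat : ∀ {n} → Vec (Fin n) n → List ℕ
flat π = map toℕ (concat (standardCycleForm π))

μ : ∀ {n} → Vec (Fin n) n → ℕ
μ π = length (standardCycleForm π)

-- Vincular pattern 23-1: indices i, k > i+1 with w_k < w_i < w_{i+1}.

contains23-1 : List ℕ → Bool
contains23-1 (a ∷ b ∷ rest) =
  ((a <ᵇ b) ∧ any (λ c → c <ᵇ a) rest) ∨ contains23-1 (b ∷ rest)
contains23-1 _ = false

avoids23-1 : List ℕ → Bool
avoids23-1 w = not (contains23-1 w)

D23-1 : (n : ℕ) → List (Vec (Fin n) n)
D23-1 n = filterᵇ (λ π → isDerangement π ∧ avoids23-1 (flat π)) (allMaps n n)

-- coefficient of y^j in e_n(y)
eCoeff : ℕ → ℕ → ℕ
eCoeff n j = length (filterᵇ (λ π → (μ π ≡ᵇ j)) (D23-1 n))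

-- Formal power series in x, y over ℚ:  F n j = coefficient of x^n y^j.

Series : Set
Series = ℕ → ℕ → ℚ

fromℕℚ : ℕ → ℚ
fromℕℚ k = + k / 1

invFact : ℕ → ℚ
invFact n = (+ 1 / (n !)) {{n !≢0}}

sumUpTo : ℕ → (ℕ → ℚ) → ℚ
sumUpTo zero    f = f 0
sumUpTo (suc n) f = sumUpTo n f +ℚ f (suc n)

infixl 6 _⊕_ _⊖_
infixl 7 _⊛_

_⊕_ : Series → Series → Series
(F ⊕ G) n j = F n j +ℚ G n j

_⊖_ : Series → Series → Series
(F ⊖ G) n j = F n j -ℚ G n j

_⊛_ : Series → Series → Series
(F ⊛ G) n j = sumUpTo n (λ a → sumUpTo j (λ b → F a b *ℚ G (n ∸ a) (j ∸ b)))

∂x : Series → Series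
∂x F n j = fromℕℚ (suc n) *ℚ F (suc n) j

oneS : Series
oneS zero zero = 1ℚ
oneS _    _    = 0ℚ

Y : Series
Y zero (suc zero) = 1ℚ
Y _    _          = 0ℚ

expX : Series
expX n zero    = invFact n
expX n (suc _) = 0ℚ

E : Series
E zero          j = 0ℚ
E (suc zero)    j = 0ℚ
E (suc (suc m)) j = fromℕℚ (eCoeff (suc (suc m)) j) *ℚ invFact (suc (suc m))

-- In the standard cycle form of a derangement the word flat π starts with its least letter s₀;
-- call s₁ the second least.  The letters D written between s₀ and s₁ in flat π must decrease, and
-- then flat π avoids 23-1 exactly when its suffix starting at s₁ does.  The first cycle either closes
-- before s₁ (the rest is an avoider on s₁ and the unused letters R, with one cycle less), closes right
-- after s₁ (the rest is an avoider on R, with one cycle less), or continues after s₁ (deleting s₀ D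
-- leaves an avoider on s₁ and R with as many cycles).  Choosing D among the n letters above s₁ gives
--   e_{n+2}(y) = Σ_{d+r=n} C(n,d) ([d ≥ 1] y e_{r+1}(y) + y e_r(y) + e_{r+1}(y)),   e₀ = 1, e₁ = 0,
-- and since binomial convolutions are products with e^x in exponential generating functions, this is
-- the coefficient form of the differential equation.

module Submission where

open import Defs

module Counting where

  open import Data.Bool using (Bool; true; false; T; not; _∧_)
  open import Data.Bool.ListAction using (any)
  open import Data.Bool.Properties using (T-∧; T-≡; T-not-≡; ∧-zeroʳ; ∧-identityʳ)
  open import Data.Empty using (⊥; ⊥-elim)
  open import Data.Fin as Fin using (Fin; toℕ; fromℕ<)
  open import Data.Fin.Properties as Fin using (toℕ-injective; toℕ<n; toℕ-fromℕ<)
  open import Data.List using (List; []; _∷_; _++_; [_]; map; concat; concatMap; length; reverse; filter; filterᵇ; allFin; upTo)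
  open import Data.List.Properties
    using (length-++; length-++-sucʳ; length-map; length-reverse; length-tabulate; length-upTo; map-++; map-∘; concat-map;
           map-injective; ++-assoc; ++-cancelˡ; ++-identityʳ-unique; ∷-injectiveˡ; ∷-injectiveʳ; unfold-reverse;
           reverse-involutive; reverse-injective)
  open import Data.List.Membership.Propositional using (_∈_; _∉_)
  open import Data.List.Membership.Propositional.Properties
    using (∈-allFin; ∈-upTo⁺; ∈-upTo⁻; ∈-∃++; ∈-++⁻; ∈-++⁺ˡ; ∈-++⁺ʳ; ∈-map⁺; ∈-map⁻; ∈-concat⁻′; ∈-concat⁺′; ∈-filter⁺; ∈-filter⁻)
  open import Data.List.Relation.Binary.Disjoint.Propositional using (Disjoint)
  open import Data.List.Relation.Binary.Permutation.Propositional using (_↭_; ↭-refl; ↭-sym; ↭⇒↭ₛ; module PermutationReasoning)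
  open import Data.List.Relation.Binary.Permutation.Propositional.Properties using (shift; ++⁺ˡ)
  import Data.List.Relation.Binary.Permutation.Setoid.Properties as Permutationₛ
  open import Data.List.Relation.Binary.Subset.Propositional using (_⊆_)
  open import Data.List.Relation.Unary.All as All using (All; []; _∷_)
  open import Data.List.Relation.Unary.All.Properties as All using (all⁺; all⁻; ¬Any⇒All¬; All¬⇒¬Any)
  open import Data.List.Relation.Unary.AllPairs as AllPairs using (AllPairs; []; _∷_)
  import Data.List.Relation.Unary.AllPairs.Properties as AllPairs
  open import Data.List.Relation.Unary.Any as Any using (here; there)
  open import Data.List.Relation.Unary.Any.Properties using (any⁺; any⁻; reverse⁺; reverse⁻)
  open import Data.List.Relation.Unary.Unique.Propositional using (Unique)
  import Data.List.Relation.Unary.Unique.Propositional.Properties as Unique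
  open import Data.Nat using (ℕ; zero; suc; _+_; _∸_; _≤_; _<_; _>_; z≤n; s≤s; _≡ᵇ_; _<ᵇ_; _≟_)
  open import Data.Nat.GeneralisedArithmetic using (fold; fold-+)
  open import Data.Nat.ListAction using (sum)
  open import Data.Nat.ListAction.Properties using (sum-++)
  open import Data.Nat.Properties
    using (≤-antisym; ≡ᵇ⇒≡; ≡⇒≡ᵇ; <ᵇ-reflects-<; <⇒<ᵇ; ≤-refl; ≤-reflexive; ≤-trans; n≤1+n; n<1+n; <-irrefl; <-asym;
           <-trans; ≤-<-trans; ≤∧≢⇒<; ≮⇒≥; <⇒≤; ≤-pred; m≤m+n; m≤n+m; m+n≤o⇒n≤o; m≤n⇒m≤1+n; m<1+n⇒m<n∨m≡n;
           m≤n⇒∃[o]m+o≡n; m∸n+n≡m; +-suc; +-comm; +-assoc; +-identityʳ; suc-injective; +-commutativeSemigroup)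
  open import Algebra.Properties.CommutativeSemigroup +-commutativeSemigroup using (interchange)
  open import Data.List.Membership.DecPropositional _≟_ using (_∈?_)
  open import Data.Product using (_×_; _,_; ∃; ∃₂; proj₁; proj₂)
  open import Data.Sum as Sum using (_⊎_; inj₁; inj₂; [_,_]′)
  open import Data.Unit using (⊤)
  open import Data.Vec using (Vec; []; _∷_; lookup; tabulate)
  open import Data.Vec.Properties using (lookup∘tabulate; tabulate∘lookup; tabulate-cong)
  import Data.Vec.Properties as Vec
  open import Function using (Equivalence; _∘_; _on_; id; flip; case_of_)
  open import Function.Definitions using (Injective)
  open import Relation.Binary.Definitions using (Asymmetric)
  open import Relation.Binary.PropositionalEquality hiding ([_])
  open import Relation.Nullary using (¬_; yes; no; does)
  open import Relation.Nullary.Decidable using (T?)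
  open import Relation.Nullary.Reflects using (Reflects; ofʸ; ofⁿ; fromEquivalence; det)
  open import Relation.Unary using (Decidable)

  private variable
    A B : Set
    x : A
    xs ys : List A

  unique-⊆⇒length≤ : Unique xs → xs ⊆ ys → length xs ≤ length ys
  unique-⊆⇒length≤ {xs = []} _ _ = z≤n
  unique-⊆⇒length≤ {xs = x ∷ xs} (x∉xs ∷ !xs) xs⊆ys with ∈-∃++ (xs⊆ys (here refl))
  ... | ys₁ , ys₂ , refl rewrite length-++-sucʳ ys₁ x ys₂ =
    s≤s (unique-⊆⇒length≤ !xs (λ y∈xs → drop ys₁ (xs⊆ys (there y∈xs)) (All.lookup x∉xs y∈xs ∘ sym)))
    where
      drop : ∀ {y} zs → y ∈ zs ++ x ∷ ys₂ → y ≢ x → y ∈ zs ++ ys₂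
      drop []       (here y≡x) y≢x = ⊥-elim (y≢x y≡x)
      drop []       (there p)  _   = p
      drop (_ ∷ _)  (here p)   _   = here p
      drop (_ ∷ zs) (there p)  y≢x = there (drop zs p y≢x)

  unique-⊆⊇⇒length≡ : Unique xs → Unique ys → xs ⊆ ys → ys ⊆ xs → length xs ≡ length ys
  unique-⊆⊇⇒length≡ !xs !ys xs⊆ys ys⊆xs =
    ≤-antisym (unique-⊆⇒length≤ !xs xs⊆ys) (unique-⊆⇒length≤ !ys ys⊆xs)

  Unique-++⁻ˡ : ∀ xs → Unique (xs ++ ys) → Unique xs
  Unique-++⁻ˡ []       _          = []
  Unique-++⁻ˡ (x ∷ xs) (x∉ ∷ !xs) = All.tabulate (All.lookup x∉ ∘ ∈-++⁺ˡ) ∷ Unique-++⁻ˡ xs !xs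

  Unique-++⁻ʳ : ∀ xs → Unique (xs ++ ys) → Unique ys
  Unique-++⁻ʳ []       !ys       = !ys
  Unique-++⁻ʳ (x ∷ xs) (_ ∷ !xs) = Unique-++⁻ʳ xs !xs

  Unique-++⇒∉ : ∀ xs → Unique (xs ++ ys) → x ∈ xs → x ∉ ys
  Unique-++⇒∉ (_ ∷ xs) (x∉ ∷ _)  (here refl)  x∈ys = All.lookup x∉ (∈-++⁺ʳ xs x∈ys) refl
  Unique-++⇒∉ (_ ∷ xs) (_ ∷ !xs) (there x∈xs) x∈ys = Unique-++⇒∉ xs !xs x∈xs x∈ys

  Unique-concat⁻ : ∀ {xss : List (List A)} → Unique (concat xss) → xs ∈ xss → Unique xs
  Unique-concat⁻ {xss = xs ∷ _}   !xss (here refl) = Unique-++⁻ˡ xs !xss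
  Unique-concat⁻ {xss = ys ∷ xss} !xss (there p)   = Unique-concat⁻ (Unique-++⁻ʳ ys !xss) p

  Unique-map⁺-on : ∀ (f : A → B) → Unique xs → (∀ {x y} → x ∈ xs → y ∈ xs → f x ≡ f y → x ≡ y) →
                   Unique (map f xs)
  Unique-map⁺-on f []                   _   = []
  Unique-map⁺-on {xs = x ∷ xs} f (x∉ ∷ !xs) inj =
    All.tabulate fx∉ ∷ Unique-map⁺-on f !xs (λ p q → inj (there p) (there q))
    where
      fx∉ : ∀ {z} → z ∈ map f xs → f x ≢ z
      fx∉ z∈ with ∈-map⁻ f z∈
      ... | y , y∈ , refl = All.lookup x∉ y∈ ∘ inj (here refl) (there y∈)

  Unique-map⇒injective-on : ∀ (f : A → B) → Unique (map f xs) →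
                            ∀ {x y} → x ∈ xs → y ∈ xs → f x ≡ f y → x ≡ y
  Unique-map⇒injective-on f _          (here refl) (here refl) _ = refl
  Unique-map⇒injective-on f (fx∉ ∷ _)  (here refl) (there q)   e = ⊥-elim (All.lookup fx∉ (∈-map⁺ f q) e)
  Unique-map⇒injective-on f (fy∉ ∷ _)  (there p)   (here refl) e = ⊥-elim (All.lookup fy∉ (∈-map⁺ f p) (sym e))
  Unique-map⇒injective-on f (_ ∷ !fxs) (there p)   (there q)   e = Unique-map⇒injective-on f !fxs p q e

  Unique-resp-↭ : xs ↭ ys → Unique xs → Unique ys
  Unique-resp-↭ = Permutationₛ.Unique-resp-↭ (setoid _) ∘ ↭⇒↭ₛ

  Unique-concatMap⁺ : ∀ {A B : Set} (f : A → List B) {xs} → Unique xs → (∀ {x} → x ∈ xs → Unique (f x)) →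
                      (∀ {x y} → x ∈ xs → y ∈ xs → x ≢ y → Disjoint (f x) (f y)) → Unique (concatMap f xs)
  Unique-concatMap⁺ f []          _    _        = []
  Unique-concatMap⁺ f {x ∷ xs} (x∉ ∷ !xs) !f disjoint =
    Unique.++⁺ (!f (here refl)) (Unique-concatMap⁺ f !xs (!f ∘ there) (λ p q → disjoint (there p) (there q)))
      λ (z∈fx , z∈rest) → case-rest z∈fx z∈rest
    where
      case-rest : ∀ {z} → z ∈ f x → z ∈ concatMap f xs → ⊥
      case-rest z∈fx z∈rest with ∈-concat⁻′ (map f xs) z∈rest
      ... | _ , z∈fy , fy∈ with ∈-map⁻ f fy∈
      ... | y , y∈xs , refl = disjoint (here refl) (there y∈xs) (All.lookup x∉ y∈xs) (z∈fx , z∈fy)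

  prefix-unique : ∀ {A : Set} {s : A} D D′ {X Y} → s ∉ D → s ∉ D′ → D ++ s ∷ X ≡ D′ ++ s ∷ Y → D ≡ D′
  prefix-unique []      []       _   _    _ = refl
  prefix-unique []      (_ ∷ _)  _   s∉D′ e = ⊥-elim (s∉D′ (here (∷-injectiveˡ e)))
  prefix-unique (_ ∷ _) []       s∉D _    e = ⊥-elim (s∉D (here (sym (∷-injectiveˡ e))))
  prefix-unique (d ∷ D) (d′ ∷ D′) s∉D s∉D′ e =
    cong₂ _∷_ (∷-injectiveˡ e) (prefix-unique D D′ (s∉D ∘ there) (s∉D′ ∘ there) (∷-injectiveʳ e))

  map-preimage : ∀ (f : A → B) {ys} → All (λ y → ∃ λ x → f x ≡ y) ys → ∃ λ xs → map f xs ≡ ys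
  map-preimage f []                    = [] , refl
  map-preimage f ((x , refl) ∷ images) with map-preimage f images
  ... | xs , refl = x ∷ xs , refl

  length-concatMap : ∀ {A B : Set} (f : A → List B) xs → length (concatMap f xs) ≡ sum (map (length ∘ f) xs)
  length-concatMap f []       = refl
  length-concatMap f (x ∷ xs) = trans (length-++ (f x)) (cong (length (f x) +_) (length-concatMap f xs))

  AllPairs-reverse : ∀ {R : A → A → Set} {xs : List A} → AllPairs R xs → AllPairs (flip R) (reverse xs)
  AllPairs-reverse {xs = []}     []         = []
  AllPairs-reverse {xs = x ∷ xs} (x~ ∷ xs~) rewrite unfold-reverse x xs =
    AllPairs.++⁺ (AllPairs-reverse xs~) ([] ∷ []) (All.tabulate λ y∈ → All.lookup x~ (reverse⁻ y∈) ∷ [])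

  module _ {n : ℕ} where

    ==F-reflects : (i j : Fin n) → Reflects (i ≡ j) (i ==F j)
    ==F-reflects i j = fromEquivalence (toℕ-injective ∘ ≡ᵇ⇒≡ _ _) (≡⇒≡ᵇ _ _ ∘ cong toℕ)

    ==F-refl : (i : Fin n) → i ==F i ≡ true
    ==F-refl i = det (==F-reflects i i) (ofʸ refl)

    ≢⇒==F≡false : {i j : Fin n} → i ≢ j → i ==F j ≡ false
    ≢⇒==F≡false {i} {j} i≢j = det (==F-reflects i j) (ofⁿ i≢j)

    elemF-reflects : (i : Fin n) (xs : List (Fin n)) → Reflects (i ∈ xs) (elemF i xs)
    elemF-reflects i xs = fromEquivalence
      (Any.map (toℕ-injective ∘ ≡ᵇ⇒≡ _ _) ∘ any⁻ _ xs)
      (any⁺ _ ∘ Any.map (≡⇒≡ᵇ _ _ ∘ cong toℕ))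

    distinct⇒Unique : (xs : List (Fin n)) → T (distinct xs) → Unique xs
    distinct⇒Unique []       _ = []
    distinct⇒Unique (x ∷ xs) t with elemF x xs | elemF-reflects x xs
    ... | false | ofⁿ x∉xs = ¬Any⇒All¬ xs x∉xs ∷ distinct⇒Unique xs t

    Unique⇒distinct : {xs : List (Fin n)} → Unique xs → T (distinct xs)
    Unique⇒distinct []               = _
    Unique⇒distinct {x ∷ xs} (x∉ ∷ !xs) with elemF x xs | elemF-reflects x xs
    ... | true  | ofʸ x∈xs = All¬⇒¬Any x∉ x∈xs
    ... | false | _        = Unique⇒distinct !xs

    isPermutation⇒injective : (π : Vec (Fin n) n) → T (isPermutation π) → Injective _≡_ _≡_ (lookup π)
    isPermutation⇒injective π t =
      Unique-map⇒injective-on (lookup π) (distinct⇒Unique _ t) (∈-allFin _) (∈-allFin _)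

    injective⇒isPermutation : (π : Vec (Fin n) n) → Injective _≡_ _≡_ (lookup π) → T (isPermutation π)
    injective⇒isPermutation π inj = Unique⇒distinct (Unique.map⁺ inj (Unique.allFin⁺ n))

    IsDerangement : Vec (Fin n) n → Set
    IsDerangement π = Injective _≡_ _≡_ (lookup π) × (∀ i → lookup π i ≢ i)

    isDerangement⇒IsDerangement : (π : Vec (Fin n) n) → T (isDerangement π) → IsDerangement π
    isDerangement⇒IsDerangement π t =
      isPermutation⇒injective π (proj₁ (Equivalence.to T-∧ t)) , λ i → fixed-free i (All.lookup noFix (∈-allFin i))
      where
        noFix : All (λ i → T (not (lookup π i ==F i))) (allFin n)
        noFix = all⁺ _ (allFin n) (proj₂ (Equivalence.to (T-∧ {isPermutation π}) t))
        fixed-free : ∀ i → T (not (lookup π i ==F i)) → lookup π i ≢ i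
        fixed-free i t with lookup π i ==F i | ==F-reflects (lookup π i) i
        ... | false | ofⁿ σi≢i = σi≢i

    IsDerangement⇒isDerangement : (π : Vec (Fin n) n) → IsDerangement π → T (isDerangement π)
    IsDerangement⇒isDerangement π (inj , noFix) =
      Equivalence.from T-∧ (injective⇒isPermutation π inj , all⁻ _ (All.tabulate fixed-free))
      where
        fixed-free : ∀ {i} → i ∈ allFin n → T (not (lookup π i ==F i))
        fixed-free {i} _ rewrite ≢⇒==F≡false (noFix i) = _

  -- Standard cycle forms

  StandardOrder : {A : Set} → (A → A → Set) → List (List A) → Set
  StandardOrder _≺_ []            = ⊤
  StandardOrder _≺_ ([] ∷ F)      = ⊥
  StandardOrder _≺_ ((c ∷ r) ∷ F) = All (c ≺_) (r ++ concat F) × StandardOrder _≺_ F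

  StandardOrder-head : ∀ {A : Set} {_≺_ : A → A → Set} → Asymmetric _≺_ →
                       ∀ {s S} F → AllPairs _≺_ (s ∷ S) → s ∈ concat F → concat F ⊆ s ∷ S →
                       StandardOrder _≺_ F → ∃₂ λ r F′ → F ≡ (s ∷ r) ∷ F′
  StandardOrder-head asym ((c ∷ r) ∷ F′) _ (here refl) _ _ = r , F′ , refl
  StandardOrder-head asym ((c ∷ r) ∷ F′) (s≺S ∷ _) (there s∈) F⊆ (c≺ , _) with F⊆ (here refl)
  ... | here refl = r , F′ , refl
  ... | there c∈S = ⊥-elim (asym (All.lookup c≺ s∈) (All.lookup s≺S c∈S))

  module CycleForm {n : ℕ} (π : Vec (Fin n) n) where

    σ : Fin n → Fin n
    σ = lookup π

    PathTo : Fin n → List (Fin n) → Set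
    PathTo c []           = ⊥
    PathTo c (x ∷ [])     = σ x ≡ c
    PathTo c (x ∷ y ∷ xs) = σ x ≡ y × PathTo c (y ∷ xs)

    IsCycle : List (Fin n) → Set
    IsCycle []       = ⊥
    IsCycle (c ∷ xs) = PathTo c (c ∷ xs)

    record IsCycleForm (F : List (List (Fin n))) : Set where
      field
        unique   : Unique (concat F)
        complete : ∀ i → i ∈ concat F
        ordered  : StandardOrder Fin._<_ F
        cycles   : All IsCycle F

    trace-self : ∀ f c → trace f π c c ≡ []
    trace-self zero    c = refl
    trace-self (suc f) c rewrite ==F-refl c = refl

    trace-path : ∀ f {c} x r → PathTo c (x ∷ r) → c ∉ x ∷ r → length (x ∷ r) ≤ f → trace f π c x ≡ x ∷ r
    trace-path (suc f) {c} x [] σx≡c c∉ _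
      rewrite ≢⇒==F≡false (c∉ ∘ here ∘ sym) | σx≡c = cong (x ∷_) (trace-self f c)
    trace-path (suc f) {c} x (y ∷ r) (σx≡y , path) c∉ (s≤s len)
      rewrite ≢⇒==F≡false (c∉ ∘ here ∘ sym) | σx≡y = cong (x ∷_) (trace-path f y r path (c∉ ∘ there) len)

    Unique⇒length≤n : {xs : List (Fin n)} → Unique xs → length xs ≤ n
    Unique⇒length≤n {xs} !xs = subst (length xs ≤_) (length-tabulate id) (unique-⊆⇒length≤ !xs (λ _ → ∈-allFin _))

    trace-IsCycle : ∀ c r → IsCycle (c ∷ r) → Unique (c ∷ r) → trace n π c (σ c) ≡ r
    trace-IsCycle c []      σc≡c _ rewrite σc≡c = trace-self n c
    trace-IsCycle c (x ∷ r) (σc≡x , path) !cr@(c∉ ∷ _) rewrite σc≡x =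
      trace-path n x r path (All¬⇒¬Any c∉) (≤-trans (n≤1+n _) (Unique⇒length≤n !cr))

    cyclesFrom-unique : ∀ L vis F → AllPairs Fin._<_ L →
                        (∀ {x} → x ∈ concat F → x ∉ vis) → (∀ {x} → x ∈ L → x ∈ concat F ⊎ x ∈ vis) →
                        concat F ⊆ L → Unique (concat F) → StandardOrder Fin._<_ F → All IsCycle F →
                        cyclesFrom π L vis ≡ F
    cyclesFrom-unique [] vis [] _ _ _ _ _ _ _ = refl
    cyclesFrom-unique [] vis ((c ∷ r) ∷ F) _ _ _ F⊆L _ _ _ with F⊆L (here refl)
    ... | ()
    cyclesFrom-unique (i ∷ L) vis F sorted@(_ ∷ sorted′) F∉vis L⊆ F⊆L !F ord cyc with elemF i vis | elemF-reflects i vis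
    ... | true | ofʸ i∈vis = cyclesFrom-unique L vis F sorted′ F∉vis (L⊆ ∘ there) F⊆L′ !F ord cyc
      where
        F⊆L′ : concat F ⊆ L
        F⊆L′ x∈F with F⊆L x∈F
        ... | here refl = ⊥-elim (F∉vis x∈F i∈vis)
        ... | there x∈L = x∈L
    ... | false | ofⁿ i∉vis with L⊆ (here refl)
    ...   | inj₂ i∈vis = ⊥-elim (i∉vis i∈vis)
    ...   | inj₁ i∈F with StandardOrder-head Fin.<-asym F sorted i∈F F⊆L ord
    ...     | r , F′ , refl
      rewrite trace-IsCycle i r (All.head cyc) (Unique-++⁻ˡ (i ∷ r) !F) =
        cong ((i ∷ r) ∷_) (cyclesFrom-unique L ((i ∷ r) ++ vis) F′ sorted′ F′∉vis L⊆′ F′⊆L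
                             (Unique-++⁻ʳ (i ∷ r) !F) (proj₂ ord) (All.tail cyc))
      where
        F′∉vis : ∀ {x} → x ∈ concat F′ → x ∉ (i ∷ r) ++ vis
        F′∉vis x∈F′ x∈ with ∈-++⁻ (i ∷ r) x∈
        ... | inj₁ x∈ir  = Unique-++⇒∉ (i ∷ r) !F x∈ir x∈F′
        ... | inj₂ x∈vis = F∉vis (∈-++⁺ʳ (i ∷ r) x∈F′) x∈vis
        L⊆′ : ∀ {x} → x ∈ L → x ∈ concat F′ ⊎ x ∈ (i ∷ r) ++ vis
        L⊆′ x∈L with L⊆ (there x∈L)
        ... | inj₂ x∈vis = inj₂ (∈-++⁺ʳ (i ∷ r) x∈vis)
        ... | inj₁ x∈F with ∈-++⁻ (i ∷ r) x∈F
        ...   | inj₁ x∈ir  = inj₂ (∈-++⁺ˡ x∈ir)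
        ...   | inj₂ x∈F′ = inj₁ x∈F′
        F′⊆L : concat F′ ⊆ L
        F′⊆L x∈F′ with F⊆L (∈-++⁺ʳ (i ∷ r) x∈F′)
        ... | here refl = ⊥-elim (Unique-++⇒∉ (i ∷ r) !F (here refl) x∈F′)
        ... | there x∈L = x∈L

    allFin-sorted : AllPairs Fin._<_ (allFin n)
    allFin-sorted = AllPairs.tabulate⁺-< id

    standardCycleForm-unique : ∀ F → IsCycleForm F → standardCycleForm π ≡ F
    standardCycleForm-unique F cf =
      cyclesFrom-unique (allFin n) [] F allFin-sorted (λ _ ()) (λ {x} _ → inj₁ (complete x)) (λ _ → ∈-allFin _)
                        unique ordered cycles
      where open IsCycleForm cf

  least : (P : ℕ → Set) → Decidable P → ∀ {d} → P d → ∃ λ k → P k × (∀ {t} → t < k → ¬ P t)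
  least P P? {d} = search 0 d (λ ())
    where
      search : ∀ m r → (∀ {t} → t < m → ¬ P t) → P (m + r) → ∃ λ k → P k × (∀ {t} → t < k → ¬ P t)
      search m r below p with P? m
      ... | yes pm = m , pm , below
      search m zero    below p | no ¬pm = ⊥-elim (¬pm (subst P (+-identityʳ m) p))
      search m (suc r) below p | no ¬pm = search (suc m) r below′ (subst P (+-suc m r) p)
        where
          below′ : ∀ {t} → t < suc m → ¬ P t
          below′ t<1+m with m<1+n⇒m<n∨m≡n t<1+m
          ... | inj₁ t<m  = below t<m
          ... | inj₂ refl = ¬pm

  m<n⇒∃[o]m+suc[o]≡n : ∀ {m n} → m < n → ∃ λ o → m + suc o ≡ n
  m<n⇒∃[o]m+suc[o]≡n {m} m<n with m≤n⇒∃[o]m+o≡n m<n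
  ... | o , m+1+o≡n = o , trans (+-suc m o) m+1+o≡n

  module Orbits {n : ℕ} (π : Vec (Fin n) n) where

    open CycleForm π

    σ^ : ℕ → Fin n → Fin n
    σ^ t x = fold x σ t

    σ^-+ : ∀ a b x → σ^ (a + b) x ≡ σ^ a (σ^ b x)
    σ^-+ a b x = fold-+ x σ a

    Reaches : Fin n → Fin n → Set
    Reaches x y = ∃ λ s → σ^ s x ≡ y

    Reaches-trans : ∀ {x y z} → Reaches x y → Reaches y z → Reaches x z
    Reaches-trans {x} (s , refl) (t , refl) = t + s , σ^-+ t s x

    segment : Fin n → ℕ → ℕ → List (Fin n)
    segment c t zero    = []
    segment c t (suc l) = σ^ t c ∷ segment c (suc t) l

    ∈-segment⁻ : ∀ c t l {x} → x ∈ segment c t l → ∃ λ s → t ≤ s × s < t + l × x ≡ σ^ s c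
    ∈-segment⁻ c t (suc l) (here refl) = t , ≤-refl , subst (t <_) (sym (+-suc t l)) (s≤s (m≤m+n t l)) , refl
    ∈-segment⁻ c t (suc l) (there x∈) with ∈-segment⁻ c (suc t) l x∈
    ... | s , t<s , s<t+l , refl = s , <⇒≤ t<s , subst (s <_) (sym (+-suc t l)) s<t+l , refl

    ∈-segment⁺ : ∀ c t l {s} → t ≤ s → s < t + l → σ^ s c ∈ segment c t l
    ∈-segment⁺ c t zero    t≤s s<t rewrite +-identityʳ t = ⊥-elim (<-irrefl refl (≤-<-trans t≤s s<t))
    ∈-segment⁺ c t (suc l) {s} t≤s s<t+l with t ≟ s
    ... | yes refl = here refl
    ... | no  t≢s  = there (∈-segment⁺ c (suc t) l (≤∧≢⇒< t≤s t≢s) (subst (s <_) (+-suc t l) s<t+l))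

    module _ (inj : Injective _≡_ _≡_ σ) where

      σ^-injective : ∀ a {x y} → σ^ a x ≡ σ^ a y → x ≡ y
      σ^-injective zero    e = e
      σ^-injective (suc a) e = σ^-injective a (inj e)

      σ^-cancel : ∀ a o c → σ^ (a + suc o) c ≡ σ^ a c → σ^ (suc o) c ≡ c
      σ^-cancel a o c e = σ^-injective a (trans (sym (σ^-+ a (suc o) c)) e)

      eventually-returns : ∀ c → ∃ λ d → σ^ (suc d) c ≡ c
      eventually-returns c with Fin.pigeonhole (n<1+n n) (λ k → σ^ (toℕ k) c)
      ... | i , j , i<j , σⁱc≡σʲc with m<n⇒∃[o]m+suc[o]≡n i<j
      ... | o , i+1+o≡j =
        o , σ^-cancel (toℕ i) o c (trans (cong (λ m → σ^ m c) i+1+o≡j) (sym σⁱc≡σʲc))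

      record Period (c : Fin n) : Set where
        field
          k       : ℕ
          returns : σ^ (suc k) c ≡ c
          minimal : ∀ {t} → t < k → σ^ (suc t) c ≢ c

      period : ∀ c → Period c
      period c with eventually-returns c
      ... | d , e with least (λ k → σ^ (suc k) c ≡ c) (λ k → σ^ (suc k) c Fin.≟ c) {d} e
      ... | k , ret , min = record { k = k ; returns = ret ; minimal = min }

      module OrbitOf (c : Fin n) where

        open Period (period c)

        σ^-distinct : ∀ {a b} → a < b → b ≤ k → σ^ a c ≢ σ^ b c
        σ^-distinct {a} a<b b≤k e with m<n⇒∃[o]m+suc[o]≡n a<b
        ... | o , refl = minimal (m+n≤o⇒n≤o a b≤k) (σ^-cancel a o c (sym e))

        segment-unique : ∀ t l → t + l ≤ suc k → Unique (segment c t l)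
        segment-unique t zero    _     = []
        segment-unique t (suc l) t+l≤ =
          All.tabulate head-fresh ∷ segment-unique (suc t) l (subst (_≤ suc k) (+-suc t l) t+l≤)
          where
            head-fresh : ∀ {y} → y ∈ segment c (suc t) l → σ^ t c ≢ y
            head-fresh y∈ with ∈-segment⁻ c (suc t) l y∈
            ... | s , t<s , s<t+l , refl =
              σ^-distinct t<s (≤-pred (≤-trans (subst (s <_) (sym (+-suc t l)) s<t+l) t+l≤))

        segment-path : ∀ t l → t + suc l ≡ suc k → PathTo c (segment c t (suc l))
        segment-path t zero t+1≡1+k with suc-injective (trans (+-comm 1 t) t+1≡1+k)
        ... | refl = returns
        segment-path t (suc l) t+l≡ = refl , segment-path (suc t) l (trans (sym (+-suc t (suc l))) t+l≡)

        cycleOf≡segment : cycleOf π c ≡ segment c 0 (suc k)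
        cycleOf≡segment =
          cong (c ∷_) (trace-IsCycle c (segment c 1 k) (segment-path 0 k refl) (segment-unique 0 (suc k) ≤-refl))

        cycleOf-unique : Unique (cycleOf π c)
        cycleOf-unique rewrite cycleOf≡segment = segment-unique 0 (suc k) ≤-refl

        cycleOf-isCycle : IsCycle (cycleOf π c)
        cycleOf-isCycle rewrite cycleOf≡segment = segment-path 0 k refl

        σ^-reduce : ∀ s → ∃ λ s′ → s′ ≤ k × σ^ s c ≡ σ^ s′ c
        σ^-reduce zero = 0 , z≤n , refl
        σ^-reduce (suc s) with σ^-reduce s
        ... | s′ , s′≤k , e with s′ ≟ k
        ...   | yes refl = 0 , z≤n , trans (cong σ e) returns
        ...   | no  s′≢k = suc s′ , ≤∧≢⇒< s′≤k s′≢k , cong σ e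

        ∈-cycleOf⁺ : ∀ {y} → Reaches c y → y ∈ cycleOf π c
        ∈-cycleOf⁺ (s , refl) with σ^-reduce s
        ... | s′ , s′≤k , e rewrite cycleOf≡segment | e = ∈-segment⁺ c 0 (suc k) z≤n (s≤s s′≤k)

        ∈-cycleOf⁻ : ∀ {y} → y ∈ cycleOf π c → Reaches c y
        ∈-cycleOf⁻ {y} y∈ with ∈-segment⁻ c 0 (suc k) (subst (y ∈_) cycleOf≡segment y∈)
        ... | s , _ , _ , y≡σˢc = s , sym y≡σˢc

        cycleOf-returns : ∀ {y} → y ∈ cycleOf π c → Reaches y c
        cycleOf-returns {y} y∈ with ∈-segment⁻ c 0 (suc k) (subst (y ∈_) cycleOf≡segment y∈)
        ... | s , _ , s≤k , refl = suc k ∸ s , (begin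
          σ^ (suc k ∸ s) (σ^ s c) ≡⟨ σ^-+ (suc k ∸ s) s c ⟨
          σ^ (suc k ∸ s + s) c    ≡⟨ cong (λ m → σ^ m c) (m∸n+n≡m (<⇒≤ s≤k)) ⟩
          σ^ (suc k) c            ≡⟨ returns ⟩
          c                       ∎)
          where open ≡-Reasoning

      record CyclesFromSpec (L vis : List (Fin n)) (out : List (List (Fin n))) : Set where
        field
          sound    : ∀ {x} → x ∈ concat out → x ∈ L × x ∉ vis
          unique   : Unique (concat out)
          complete : ∀ {x} → x ∈ L → x ∉ vis → x ∈ concat out
          ordered  : StandardOrder Fin._<_ out
          cycles   : All IsCycle out

      Closed : List (Fin n) → Set
      Closed vis = ∀ {x y} → x ∈ vis → Reaches x y → y ∈ vis

      spec-skip : ∀ {i L vis out} → i ∈ vis → CyclesFromSpec L vis out → CyclesFromSpec (i ∷ L) vis out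
      spec-skip {i} {L} {vis} {out} i∈vis spec = record
        { sound    = λ x∈ → there (proj₁ (sound x∈)) , proj₂ (sound x∈)
        ; unique   = unique
        ; complete = complete′
        ; ordered  = ordered
        ; cycles   = cycles
        }
        where
          open CyclesFromSpec spec
          complete′ : ∀ {x} → x ∈ i ∷ L → x ∉ vis → x ∈ concat out
          complete′ (here refl) x∉vis = ⊥-elim (x∉vis i∈vis)
          complete′ (there x∈L) x∉vis = complete x∈L x∉vis

      spec-new-cycle : ∀ {i L vis out} → All (i Fin.<_) L → i ∉ vis → (∀ x → x ∈ i ∷ L ⊎ x ∈ vis) → Closed vis →
                       CyclesFromSpec L (cycleOf π i ++ vis) out → CyclesFromSpec (i ∷ L) vis (cycleOf π i ∷ out)
      spec-new-cycle {i} {L} {vis} {out} i<L i∉vis cover closed spec = record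
        { sound    = sound′
        ; unique   = Unique.++⁺ cycleOf-unique unique (λ (x∈C , x∈out) → proj₂ (sound x∈out) (∈-++⁺ˡ x∈C))
        ; complete = complete′
        ; ordered  = All.tabulate i<rest , ordered
        ; cycles   = cycleOf-isCycle ∷ cycles
        }
        where
          open CyclesFromSpec spec
          open OrbitOf i
          C : List (Fin n)
          C = cycleOf π i
          C⊆ : ∀ {x} → x ∈ C → x ∈ i ∷ L × x ∉ vis
          C⊆ {x} x∈C with cover x
          ... | inj₁ x∈iL  = x∈iL , λ x∈vis → i∉vis (closed x∈vis (cycleOf-returns x∈C))
          ... | inj₂ x∈vis = ⊥-elim (i∉vis (closed x∈vis (cycleOf-returns x∈C)))
          sound′ : ∀ {x} → x ∈ C ++ concat out → x ∈ i ∷ L × x ∉ vis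
          sound′ x∈ with ∈-++⁻ C x∈
          ... | inj₁ x∈C   = C⊆ x∈C
          ... | inj₂ x∈out = there (proj₁ (sound x∈out)) , proj₂ (sound x∈out) ∘ ∈-++⁺ʳ C
          complete′ : ∀ {x} → x ∈ i ∷ L → x ∉ vis → x ∈ C ++ concat out
          complete′ (here refl) _ = here refl
          complete′ {x} (there x∈L) x∉vis with Any.any? (x Fin.≟_) C
          ... | yes x∈C = ∈-++⁺ˡ x∈C
          ... | no  x∉C = ∈-++⁺ʳ C (complete x∈L ([ x∉C , x∉vis ]′ ∘ ∈-++⁻ C))
          i<rest : ∀ {y} → y ∈ trace n π i (σ i) ++ concat out → i Fin.< y
          i<rest y∈ with ∈-++⁻ (trace n π i (σ i)) y∈
          ... | inj₂ y∈out = All.lookup i<L (proj₁ (sound y∈out))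
          ... | inj₁ y∈r with proj₁ (C⊆ (there y∈r))
          ...   | here refl = ⊥-elim (All¬⇒¬Any (AllPairs.head cycleOf-unique) y∈r)
          ...   | there y∈L = All.lookup i<L y∈L

      shift-cover : ∀ {i : Fin n} {L vis vis′} → (∀ x → x ∈ i ∷ L ⊎ x ∈ vis) → i ∈ vis′ → vis ⊆ vis′ →
                    ∀ x → x ∈ L ⊎ x ∈ vis′
      shift-cover cover i∈vis′ vis⊆vis′ x with cover x
      ... | inj₁ (here refl)  = inj₂ i∈vis′
      ... | inj₁ (there x∈L) = inj₁ x∈L
      ... | inj₂ x∈vis       = inj₂ (vis⊆vis′ x∈vis)

      cyclesFrom-spec : ∀ L vis → AllPairs Fin._<_ L → (∀ x → x ∈ L ⊎ x ∈ vis) → Closed vis →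
                        CyclesFromSpec L vis (cyclesFrom π L vis)
      cyclesFrom-spec [] vis _ _ _ = record
        { sound = λ () ; unique = [] ; complete = λ () ; ordered = _ ; cycles = [] }
      cyclesFrom-spec (i ∷ L) vis (i<L ∷ sorted) cover closed with elemF i vis | elemF-reflects i vis
      ... | true  | ofʸ i∈vis =
        spec-skip i∈vis (cyclesFrom-spec L vis sorted (shift-cover cover i∈vis id) closed)
      ... | false | ofⁿ i∉vis =
        spec-new-cycle i<L i∉vis cover closed
          (cyclesFrom-spec L (C ++ vis) sorted (shift-cover cover (here refl) (∈-++⁺ʳ C)) closed′)
        where
          open OrbitOf i
          C : List (Fin n)
          C = cycleOf π i
          closed′ : Closed (C ++ vis)
          closed′ x∈ x↝y with ∈-++⁻ C x∈
          ... | inj₁ x∈C   = ∈-++⁺ˡ (∈-cycleOf⁺ (Reaches-trans (∈-cycleOf⁻ x∈C) x↝y))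
          ... | inj₂ x∈vis = ∈-++⁺ʳ C (closed x∈vis x↝y)

      standardCycleForm-isCycleForm : IsCycleForm (standardCycleForm π)
      standardCycleForm-isCycleForm = record
        { unique = unique ; complete = λ x → complete (∈-allFin x) (λ ()) ; ordered = ordered ; cycles = cycles }
        where open CyclesFromSpec (cyclesFrom-spec (allFin n) [] allFin-sorted (inj₁ ∘ ∈-allFin) (λ ()))

  -- The permutation with a given cycle decomposition

  AtLeastTwo : {A : Set} → List A → Set
  AtLeastTwo (_ ∷ _ ∷ _) = ⊤
  AtLeastTwo _           = ⊥

  module _ {n : ℕ} where

    arcs : Fin n → List (Fin n) → List (Fin n × Fin n)
    arcs c []           = []
    arcs c (x ∷ [])     = (x , c) ∷ []
    arcs c (x ∷ y ∷ xs) = (x , y) ∷ arcs c (y ∷ xs)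

    cycleArcs : List (Fin n) → List (Fin n × Fin n)
    cycleArcs []       = []
    cycleArcs (c ∷ xs) = arcs c (c ∷ xs)

    graph : List (List (Fin n)) → List (Fin n × Fin n)
    graph = concatMap cycleArcs

    sources-arcs : ∀ c xs → map proj₁ (arcs c xs) ≡ xs
    sources-arcs c []           = refl
    sources-arcs c (x ∷ [])     = refl
    sources-arcs c (x ∷ y ∷ xs) = cong (x ∷_) (sources-arcs c (y ∷ xs))

    targets-arcs : ∀ c x xs → map proj₂ (arcs c (x ∷ xs)) ≡ xs ++ [ c ]
    targets-arcs c x []       = refl
    targets-arcs c x (y ∷ xs) = cong (y ∷_) (targets-arcs c y xs)

    sources-graph : ∀ F → map proj₁ (graph F) ≡ concat F
    sources-graph []      = refl
    sources-graph (C ∷ F) = begin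
      map proj₁ (cycleArcs C ++ graph F)           ≡⟨ map-++ proj₁ (cycleArcs C) (graph F) ⟩
      map proj₁ (cycleArcs C) ++ map proj₁ (graph F) ≡⟨ cong₂ _++_ (sources C) (sources-graph F) ⟩
      C ++ concat F                                 ∎
      where
        open ≡-Reasoning
        sources : ∀ C → map proj₁ (cycleArcs C) ≡ C
        sources []      = refl
        sources (c ∷ r) = sources-arcs c (c ∷ r)

    targets-graph : ∀ F → map proj₂ (graph F) ↭ concat F
    targets-graph []            = ↭-refl
    targets-graph ([] ∷ F)      = targets-graph F
    targets-graph ((c ∷ r) ∷ F) = begin
      map proj₂ (arcs c (c ∷ r) ++ graph F)               ≡⟨ map-++ proj₂ (arcs c (c ∷ r)) (graph F) ⟩
      map proj₂ (arcs c (c ∷ r)) ++ map proj₂ (graph F)   ≡⟨ cong (_++ map proj₂ (graph F)) (targets-arcs c c r) ⟩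
      (r ++ [ c ]) ++ map proj₂ (graph F)                 ≡⟨ ++-assoc r [ c ] (map proj₂ (graph F)) ⟩
      r ++ c ∷ map proj₂ (graph F)                        ↭⟨ shift c r (map proj₂ (graph F)) ⟩
      c ∷ r ++ map proj₂ (graph F)                        ↭⟨ ++⁺ˡ (c ∷ r) (targets-graph F) ⟩
      c ∷ r ++ concat F                                   ∎
      where open PermutationReasoning

    successor : List (Fin n × Fin n) → Fin n → Fin n
    successor []             x = x
    successor ((a , b) ∷ ps) x with a Fin.≟ x
    ... | yes _ = b
    ... | no  _ = successor ps x

    successor-correct : ∀ ps {x y} → Unique (map proj₁ ps) → (x , y) ∈ ps → successor ps x ≡ y
    successor-correct ((a , b) ∷ ps) _ (here refl) with a Fin.≟ a
    ... | yes _   = refl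
    ... | no  a≢a = ⊥-elim (a≢a refl)
    successor-correct ((a , b) ∷ ps) {x} (a∉ ∷ !ps) (there xy∈ps) with a Fin.≟ x
    ... | yes refl = ⊥-elim (All¬⇒¬Any a∉ (∈-map⁺ proj₁ xy∈ps))
    ... | no  _    = successor-correct ps !ps xy∈ps

    arcs-irreflexive : ∀ c xs → Unique (c ∷ xs) → ∀ {a b} → (a , b) ∈ arcs c xs → a ≢ b
    arcs-irreflexive c (x ∷ [])     (c∉ ∷ _)               (here refl) x≡c = All.head c∉ (sym x≡c)
    arcs-irreflexive c (x ∷ y ∷ xs) (_ ∷ x∉ ∷ _)           (here refl)     = All.head x∉
    arcs-irreflexive c (x ∷ y ∷ xs) ((_ ∷ c∉) ∷ _ ∷ !yxs) (there ab∈)     =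
      arcs-irreflexive c (y ∷ xs) (c∉ ∷ !yxs) ab∈

    cycleArcs-irreflexive : ∀ C → AtLeastTwo C → Unique C → ∀ {a b} → (a , b) ∈ cycleArcs C → a ≢ b
    cycleArcs-irreflexive (c ∷ d ∷ r) _ (c∉ ∷ _) (here refl)  = All.head c∉
    cycleArcs-irreflexive (c ∷ d ∷ r) _ !C       (there ab∈) = arcs-irreflexive c (d ∷ r) !C ab∈

  module FromCycles {n : ℕ} (F : List (List (Fin n))) (!F : Unique (concat F)) (cover : ∀ i → i ∈ concat F) where

    π : Vec (Fin n) n
    π = tabulate (successor (graph F))

    open CycleForm π

    σ-arc : ∀ {x y} → (x , y) ∈ graph F → σ x ≡ y
    σ-arc {x} xy∈ =
      trans (lookup∘tabulate _ x) (successor-correct (graph F) (subst Unique (sym (sources-graph F)) !F) xy∈)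

    arc-of : ∀ x → (x , σ x) ∈ graph F
    arc-of x with ∈-map⁻ proj₁ (subst (x ∈_) (sym (sources-graph F)) (cover x))
    ... | (a , b) , ab∈ , refl rewrite σ-arc ab∈ = ab∈

    σ-injective : Injective _≡_ _≡_ σ
    σ-injective {x} {y} σx≡σy = cong proj₁
      (Unique-map⇒injective-on proj₂ (Unique-resp-↭ (↭-sym (targets-graph F)) !F) (arc-of x) (arc-of y) σx≡σy)

    path-arcs : ∀ c x xs → (∀ {a b} → (a , b) ∈ arcs c (x ∷ xs) → σ a ≡ b) → PathTo c (x ∷ xs)
    path-arcs c x []       σ≡ = σ≡ (here refl)
    path-arcs c x (y ∷ xs) σ≡ = σ≡ (here refl) , path-arcs c y xs (σ≡ ∘ there)

    cycles : All AtLeastTwo F → All IsCycle F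
    cycles twos = All.tabulate λ {C} C∈F → cycle C C∈F (All.lookup twos C∈F)
      where
        cycle : ∀ C → C ∈ F → AtLeastTwo C → IsCycle C
        cycle (c ∷ r) C∈F _ = path-arcs c c r (λ ab∈ → σ-arc (∈-concat⁺′ ab∈ (∈-map⁺ cycleArcs C∈F)))

    fixed-point-free : All AtLeastTwo F → ∀ x → σ x ≢ x
    fixed-point-free twos x with ∈-concat⁻′ (map cycleArcs F) (arc-of x)
    ... | _ , x↦σx , as∈ with ∈-map⁻ cycleArcs as∈
    ... | C , C∈F , refl =
      cycleArcs-irreflexive C (All.lookup twos C∈F) (Unique-concat⁻ !F C∈F) x↦σx ∘ sym

  module _ {n : ℕ} (π π′ : Vec (Fin n) n) where

    private
      module C  = CycleForm π
      module C′ = CycleForm π′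

    paths-agree : ∀ c xs → C.PathTo c xs → C′.PathTo c xs → ∀ {x} → x ∈ xs → lookup π x ≡ lookup π′ x
    paths-agree c (x ∷ [])     p       p′       (here refl) = trans p (sym p′)
    paths-agree c (x ∷ y ∷ xs) (p , _) (p′ , _) (here refl) = trans p (sym p′)
    paths-agree c (x ∷ y ∷ xs) (_ , q) (_ , q′) (there x∈)  = paths-agree c (y ∷ xs) q q′ x∈

    common-cycleForm⇒≡ : ∀ F → C.IsCycleForm F → All C′.IsCycle F → π ≡ π′
    common-cycleForm⇒≡ F cf cycles′ =
      trans (sym (tabulate∘lookup π)) (trans (tabulate-cong agree) (tabulate∘lookup π′))
      where
        open C.IsCycleForm cf
        agree : ∀ i → lookup π i ≡ lookup π′ i
        agree i with ∈-concat⁻′ F (complete i)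
        ... | c ∷ r , i∈C , C∈F = paths-agree c (c ∷ r) (All.lookup cycles C∈F) (All.lookup cycles′ C∈F) i∈C

  -- Counting by labelled cycle forms

  map-++-concat : ∀ {A B : Set} (f : A → B) xs F → map f (xs ++ concat F) ≡ map f xs ++ concat (map (map f) F)
  map-++-concat f xs F = trans (map-++ f xs (concat F)) (cong (map f xs ++_) (sym (concat-map F)))

  module _ {A B : Set} {_≺_ : B → B → Set} (f : A → B) where

    StandardOrder-map⁺ : ∀ F → StandardOrder (_≺_ on f) F → StandardOrder _≺_ (map (map f) F)
    StandardOrder-map⁺ []            _          = _
    StandardOrder-map⁺ ((c ∷ r) ∷ F) (c≺ , ord) =
      subst (All (f c ≺_)) (map-++-concat f r F) (All.map⁺ c≺) , StandardOrder-map⁺ F ord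

    StandardOrder-map⁻ : ∀ F → StandardOrder _≺_ (map (map f) F) → StandardOrder (_≺_ on f) F
    StandardOrder-map⁻ []            _          = _
    StandardOrder-map⁻ ((c ∷ r) ∷ F) (c≺ , ord) =
      All.map⁻ (subst (All (f c ≺_)) (sym (map-++-concat f r F)) c≺) , StandardOrder-map⁻ F ord

  module _ {A B : Set} (f : A → B) where

    AtLeastTwo-map⁺ : ∀ {xs} → AtLeastTwo xs → AtLeastTwo (map f xs)
    AtLeastTwo-map⁺ {_ ∷ _ ∷ _} _ = _

    AtLeastTwo-map⁻ : ∀ {xs} → AtLeastTwo (map f xs) → AtLeastTwo xs
    AtLeastTwo-map⁻ {_ ∷ _ ∷ _} _ = _

  allMaps-unique : ∀ k m → Unique (allMaps k m)
  allMaps-unique zero    m = [] ∷ []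
  allMaps-unique (suc k) m = Unique.concat⁺
    (All.map⁺ (All.tabulate λ _ → Unique.map⁺ Vec.∷-injectiveʳ (allMaps-unique k m)))
    (AllPairs.map⁺ (AllPairs.map disjoint (Unique.allFin⁺ m)))
    where
      disjoint : ∀ {x y} → x ≢ y → Disjoint (map (x ∷_) (allMaps k m)) (map (y ∷_) (allMaps k m))
      disjoint x≢y (p , q) with ∈-map⁻ _ p | ∈-map⁻ _ q
      ... | _ , _ , refl | _ , _ , e = x≢y (Vec.∷-injectiveˡ e)

  allMaps-complete : ∀ {k m} (w : Vec (Fin m) k) → w ∈ allMaps k m
  allMaps-complete []                = here refl
  allMaps-complete {suc k} {m} (x ∷ w) =
    ∈-concat⁺′ (∈-map⁺ (x ∷_) (allMaps-complete w)) (∈-map⁺ (λ y → map (y ∷_) (allMaps k m)) (∈-allFin x))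

  record AvoidingArrangement (S w : List ℕ) : Set where
    field
      unique   : Unique w
      sound    : w ⊆ S
      complete : S ⊆ w
      avoids   : T (avoids23-1 w)

  record AvoidingCycleForm (S : List ℕ) (j : ℕ) (F : List (List ℕ)) : Set where
    field
      nontrivial  : All AtLeastTwo F
      ordered     : StandardOrder _<_ F
      arrangement : AvoidingArrangement S (concat F)
      #cycles     : length F ≡ j

    open AvoidingArrangement arrangement public

  module _ {n : ℕ} where

    labelledCycleForm : Vec (Fin n) n → List (List ℕ)
    labelledCycleForm π = map (map toℕ) (standardCycleForm π)

    concat-labelledCycleForm : ∀ π → concat (labelledCycleForm π) ≡ flat π
    concat-labelledCycleForm π = concat-map (standardCycleForm π)

    map-toℕ⊆upTo : (xs : List (Fin n)) → map toℕ xs ⊆ upTo n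
    map-toℕ⊆upTo xs x∈ with ∈-map⁻ toℕ x∈
    ... | i , _ , refl = ∈-upTo⁺ (toℕ<n i)

    upTo⊆map-toℕ : {xs : List (Fin n)} → (∀ i → i ∈ xs) → upTo n ⊆ map toℕ xs
    upTo⊆map-toℕ complete x∈ =
      subst (_∈ _) (toℕ-fromℕ< (∈-upTo⁻ x∈)) (∈-map⁺ toℕ (complete (fromℕ< (∈-upTo⁻ x∈))))

    derangement-cycle : ∀ (π : Vec (Fin n) n) → IsDerangement π → ∀ {C} → CycleForm.IsCycle π C → AtLeastTwo C
    derangement-cycle π (_ , noFix) {c ∷ []}    σc≡c = noFix c σc≡c
    derangement-cycle π _           {_ ∷ _ ∷ _} _    = _

    labelledCycleForm-avoiding : ∀ π → IsDerangement π → T (avoids23-1 (flat π)) →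
                                 AvoidingCycleForm (upTo n) (μ π) (labelledCycleForm π)
    labelledCycleForm-avoiding π derangement avoids = record
      { nontrivial  = All.map⁺ (All.map (AtLeastTwo-map⁺ toℕ ∘ derangement-cycle π derangement) cycles)
      ; ordered     = StandardOrder-map⁺ toℕ _ ordered
      ; arrangement = record
        { unique   = subst Unique (sym concat≡) (Unique.map⁺ toℕ-injective unique)
        ; sound    = map-toℕ⊆upTo _ ∘ subst (_ ∈_) concat≡
        ; complete = subst (_ ∈_) (sym concat≡) ∘ upTo⊆map-toℕ complete
        ; avoids   = subst (T ∘ avoids23-1) (sym concat≡) avoids
        }
      ; #cycles     = length-map (map toℕ) (standardCycleForm π)
      }
      where
        open CycleForm π using (module IsCycleForm)
        open IsCycleForm (Orbits.standardCycleForm-isCycleForm π (proj₁ derangement))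
        concat≡ : concat (labelledCycleForm π) ≡ flat π
        concat≡ = concat-labelledCycleForm π

    lift-labels : ∀ F → concat F ⊆ upTo n → ∃ λ (G : List (List (Fin n))) → map (map toℕ) G ≡ F
    lift-labels F F⊆ = map-preimage (map toℕ) (All.tabulate λ C∈F → map-preimage toℕ
      (All.tabulate λ x∈C → let x<n = ∈-upTo⁻ (F⊆ (∈-concat⁺′ x∈C C∈F)) in fromℕ< x<n , toℕ-fromℕ< x<n))

    avoiding⇒labelledCycleForm : ∀ j F → AvoidingCycleForm (upTo n) j F →
      ∃ λ π → IsDerangement π × T (avoids23-1 (flat π)) × μ π ≡ j × labelledCycleForm π ≡ F
    avoiding⇒labelledCycleForm j F form with lift-labels F (AvoidingCycleForm.sound form)
    ... | G , refl = π , (σ-injective , fixed-point-free twos) , avoids′ , #cycles′ , cong (map (map toℕ)) scf≡G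
      where
        open AvoidingCycleForm form
        concat≡ : concat (map (map toℕ) G) ≡ map toℕ (concat G)
        concat≡ = concat-map G
        !G : Unique (concat G)
        !G = Unique.map⁻ (subst Unique concat≡ unique)
        coverG : ∀ i → i ∈ concat G
        coverG i with ∈-map⁻ toℕ (subst (_ ∈_) concat≡ (complete (map-toℕ⊆upTo (allFin n) (∈-map⁺ toℕ (∈-allFin i)))))
        ... | i′ , i′∈G , toℕi≡toℕi′ = subst (_∈ concat G) (sym (toℕ-injective toℕi≡toℕi′)) i′∈G
        twos : All AtLeastTwo G
        twos = All.map (AtLeastTwo-map⁻ toℕ) (All.map⁻ nontrivial)
        open FromCycles G !G coverG
        scf≡G : standardCycleForm π ≡ G
        scf≡G = CycleForm.standardCycleForm-unique π G record
          { unique = !G ; complete = coverG ; ordered = StandardOrder-map⁻ toℕ G ordered ; cycles = cycles twos }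
        avoids′ : T (avoids23-1 (flat π))
        avoids′ rewrite scf≡G = subst (T ∘ avoids23-1) concat≡ avoids
        #cycles′ : μ π ≡ j
        #cycles′ rewrite scf≡G = trans (sym (length-map (map toℕ) G)) #cycles

    labelledCycleForm-injective : ∀ π π′ → IsDerangement π → IsDerangement π′ →
                                  labelledCycleForm π ≡ labelledCycleForm π′ → π ≡ π′
    labelledCycleForm-injective π π′ (inj , _) (inj′ , _) e =
      common-cycleForm⇒≡ π π′ (standardCycleForm π) cf (subst (All (CycleForm.IsCycle π′)) (sym scf≡) cycles′)
      where
        scf≡ : standardCycleForm π ≡ standardCycleForm π′
        scf≡ = map-injective (map-injective toℕ-injective) e
        cf : CycleForm.IsCycleForm π (standardCycleForm π)
        cf = Orbits.standardCycleForm-isCycleForm π inj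
        cycles′ : All (CycleForm.IsCycle π′) (standardCycleForm π′)
        cycles′ = CycleForm.IsCycleForm.cycles (Orbits.standardCycleForm-isCycleForm π′ inj′)

  eCoeff≡#avoidingForms : ∀ n j Fs → Unique Fs →
                          (∀ {F} → F ∈ Fs → AvoidingCycleForm (upTo n) j F) →
                          (∀ {F} → AvoidingCycleForm (upTo n) j F → F ∈ Fs) →
                          eCoeff n j ≡ length Fs
  eCoeff≡#avoidingForms n j Fs !Fs Fs-sound Fs-complete = begin
    length L                       ≡⟨ length-map labelledCycleForm L ⟨
    length (map labelledCycleForm L) ≡⟨ unique-⊆⊇⇒length≡ !labelled !Fs fwd bwd ⟩
    length Fs                      ∎
    where
      open ≡-Reasoning
      isD23 : Vec (Fin n) n → Bool
      isD23 π = isDerangement π ∧ avoids23-1 (flat π)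
      L : List (Vec (Fin n) n)
      L = filterᵇ (λ π → μ π ≡ᵇ j) (D23-1 n)
      properties : ∀ {π} → π ∈ L → IsDerangement π × T (avoids23-1 (flat π)) × μ π ≡ j
      properties {π} π∈L with ∈-filter⁻ (T? ∘ (λ π → μ π ≡ᵇ j)) {xs = D23-1 n} π∈L
      ... | π∈D , μ≡ with ∈-filter⁻ (T? ∘ isD23) {xs = allMaps n n} π∈D
      ... | _ , t with Equivalence.to T-∧ t
      ... | d , a = isDerangement⇒IsDerangement π d , a , ≡ᵇ⇒≡ _ _ μ≡
      !labelled : Unique (map labelledCycleForm L)
      !labelled = Unique-map⁺-on labelledCycleForm
        (Unique.filter⁺ _ (Unique.filter⁺ _ (allMaps-unique n n)))
        (λ p q → labelledCycleForm-injective _ _ (proj₁ (properties p)) (proj₁ (properties q)))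
      fwd : map labelledCycleForm L ⊆ Fs
      fwd F∈ with ∈-map⁻ labelledCycleForm F∈
      ... | π , π∈L , refl with properties π∈L
      ... | d , a , refl = Fs-complete (labelledCycleForm-avoiding π d a)
      bwd : Fs ⊆ map labelledCycleForm L
      bwd F∈Fs with avoiding⇒labelledCycleForm j _ (Fs-sound F∈Fs)
      ... | π , d , a , μ≡j , refl = ∈-map⁺ labelledCycleForm
        (∈-filter⁺ _ (∈-filter⁺ _ (allMaps-complete π) (Equivalence.from T-∧ (IsDerangement⇒isDerangement π d , a)))
                     (≡⇒≡ᵇ _ _ μ≡j))

  -- Avoiding 23-1

  Ascending Descending : List ℕ → Set
  Ascending  = AllPairs _<_
  Descending = AllPairs _>_

  Ascending⇒Unique : ∀ {xs} → Ascending xs → Unique xs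
  Ascending⇒Unique = AllPairs.map (λ x<y x≡y → <-irrefl x≡y x<y)

  Descending⇒Unique : ∀ {xs} → Descending xs → Unique xs
  Descending⇒Unique = AllPairs.map (λ x>y x≡y → <-irrefl (sym x≡y) x>y)

  ascending-⊆⊇⇒≡ : ∀ {xs ys} → Ascending xs → Ascending ys → xs ⊆ ys → ys ⊆ xs → xs ≡ ys
  ascending-⊆⊇⇒≡ {[]}     {[]}     _ _ _ _ = refl
  ascending-⊆⊇⇒≡ {[]}     {y ∷ ys} _ _ _ ys⊆ with ys⊆ (here refl)
  ... | ()
  ascending-⊆⊇⇒≡ {x ∷ xs} {[]}     _ _ xs⊆ _ with xs⊆ (here refl)
  ... | ()
  ascending-⊆⊇⇒≡ {x ∷ xs} {y ∷ ys} (x< ∷ xs↗) (y< ∷ ys↗) xs⊆ ys⊆ with xs⊆ (here refl) | ys⊆ (here refl)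
  ... | here refl | _ = cong (x ∷_) (ascending-⊆⊇⇒≡ xs↗ ys↗ (tail-⊆ x< xs⊆) (tail-⊆ y< ys⊆))
    where
      tail-⊆ : ∀ {zs ws} → All (x <_) zs → x ∷ zs ⊆ x ∷ ws → zs ⊆ ws
      tail-⊆ x<zs ⊆ z∈ with ⊆ (there z∈)
      ... | here refl = ⊥-elim (<-irrefl refl (All.lookup x<zs z∈))
      ... | there z∈ws = z∈ws
  ... | there x∈ys | here refl   = ⊥-elim (<-irrefl refl (All.lookup y< x∈ys))
  ... | there x∈ys | there y∈xs = ⊥-elim (<-asym (All.lookup y< x∈ys) (All.lookup x< y∈xs))

  <ᵇ≡false : ∀ {m n} → ¬ m < n → (m <ᵇ n) ≡ false
  <ᵇ≡false {m} {n} m≮n = det (<ᵇ-reflects-< m n) (ofⁿ m≮n)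

  any-<ᵇ-false : ∀ s xs → All (s <_) xs → any (_<ᵇ s) xs ≡ false
  any-<ᵇ-false s []       _           = refl
  any-<ᵇ-false s (x ∷ xs) (s<x ∷ s<xs) rewrite <ᵇ≡false (<-asym s<x) = any-<ᵇ-false s xs s<xs

  any-<ᵇ-true : ∀ s xs {x} → x ∈ xs → x < s → any (_<ᵇ s) xs ≡ true
  any-<ᵇ-true s xs x∈xs x<s =
    Equivalence.to T-≡ (any⁺ (_<ᵇ s) (Any.map (λ { refl → <⇒<ᵇ x<s }) x∈xs))

  contains23-1-∷-min : ∀ s w → All (s <_) w → contains23-1 (s ∷ w) ≡ contains23-1 w
  contains23-1-∷-min s []      _         = refl
  contains23-1-∷-min s (b ∷ w) (_ ∷ s<w) rewrite any-<ᵇ-false s w s<w | ∧-zeroʳ (s <ᵇ b) = refl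

  contains23-1-descent⁻ : ∀ D s w → Unique D → All (s <_) D → contains23-1 (D ++ s ∷ w) ≡ false →
                          Descending D × contains23-1 (s ∷ w) ≡ false
  contains23-1-descent⁻ []           s w _ _ e = [] , e
  contains23-1-descent⁻ (d ∷ [])     s w _ (s<d ∷ _) e rewrite <ᵇ≡false (<-asym s<d) = [] ∷ [] , e
  contains23-1-descent⁻ (d ∷ d′ ∷ D) s w (d∉ ∷ !D) (s<d ∷ s<D) e
    rewrite any-<ᵇ-true d (D ++ s ∷ w) (∈-++⁺ʳ D (here refl)) s<d | ∧-identityʳ (d <ᵇ d′)
    with d <ᵇ d′ | <ᵇ-reflects-< d d′
  ... | false | ofⁿ d≮d′ with contains23-1-descent⁻ (d′ ∷ D) s w !D s<D e
  ...   | desc@(d′>D ∷ _) , e′ = (d′<d ∷ All.map (λ x<d′ → <-trans x<d′ d′<d) d′>D) ∷ desc , e′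
    where
      d′<d : d′ < d
      d′<d = ≤∧≢⇒< (≮⇒≥ d≮d′) (All.head d∉ ∘ sym)

  contains23-1-descent⁺ : ∀ D s w → Descending D → All (s <_) D → contains23-1 (s ∷ w) ≡ false →
                          contains23-1 (D ++ s ∷ w) ≡ false
  contains23-1-descent⁺ []           s w _ _ e = e
  contains23-1-descent⁺ (d ∷ [])     s w _ (s<d ∷ _) e rewrite <ᵇ≡false (<-asym s<d) = e
  contains23-1-descent⁺ (d ∷ d′ ∷ D) s w ((d>d′ ∷ _) ∷ desc) (_ ∷ s<D) e
    rewrite <ᵇ≡false (<-asym d>d′) = contains23-1-descent⁺ (d′ ∷ D) s w desc s<D e

  avoids23-1-∷-min : ∀ s w → All (s <_) w → avoids23-1 (s ∷ w) ≡ avoids23-1 w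
  avoids23-1-∷-min s w s<w = cong not (contains23-1-∷-min s w s<w)

  -- With s₀ below all letters and D above s₁, an occurrence of 23-1 in s₀ D s₁ w is either an ascent
  -- inside D (completed by s₁) or an occurrence inside s₁ w.
  avoids23-1-prefix⁺ : ∀ s₀ D s₁ w → All (s₀ <_) (D ++ s₁ ∷ w) → Descending D → All (s₁ <_) D →
                       T (avoids23-1 (s₁ ∷ w)) → T (avoids23-1 (s₀ ∷ D ++ s₁ ∷ w))
  avoids23-1-prefix⁺ s₀ D s₁ w s₀< desc s₁<D avoids = Equivalence.from T-not-≡
    (trans (contains23-1-∷-min s₀ _ s₀<) (contains23-1-descent⁺ D s₁ w desc s₁<D (Equivalence.to T-not-≡ avoids)))

  avoids23-1-prefix⁻ : ∀ s₀ D s₁ w → All (s₀ <_) (D ++ s₁ ∷ w) → Unique D → All (s₁ <_) D →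
                       T (avoids23-1 (s₀ ∷ D ++ s₁ ∷ w)) → Descending D × T (avoids23-1 (s₁ ∷ w))
  avoids23-1-prefix⁻ s₀ D s₁ w s₀< !D s₁<D avoids
    with contains23-1-descent⁻ D s₁ w !D s₁<D
           (trans (sym (contains23-1-∷-min s₀ _ s₀<)) (Equivalence.to T-not-≡ avoids))
  ... | desc , e = desc , Equivalence.from T-not-≡ e

  -- Enumerating avoiding cycle forms

  masks : ℕ → List (List Bool)
  masks zero    = [ [] ]
  masks (suc n) = map (true ∷_) (masks n) ++ map (false ∷_) (masks n)

  select : {A : Set} → List Bool → List A → List A
  select (true  ∷ m) (x ∷ xs) = x ∷ select m xs
  select (false ∷ m) (x ∷ xs) = select m xs
  select _           _        = []

  module _ {A : Set} where

    select-⊆ : ∀ m (S : List A) → select m S ⊆ S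
    select-⊆ (true  ∷ m) (y ∷ S) (here refl) = here refl
    select-⊆ (true  ∷ m) (y ∷ S) (there x∈)  = there (select-⊆ m S x∈)
    select-⊆ (false ∷ m) (y ∷ S) x∈          = there (select-⊆ m S x∈)

    select-split : ∀ m (S : List A) → length m ≡ length S → ∀ {x} → x ∈ S → x ∈ select m S ⊎ x ∈ select (map not m) S
    select-split (true  ∷ m) (y ∷ S) _ (here refl) = inj₁ (here refl)
    select-split (false ∷ m) (y ∷ S) _ (here refl) = inj₂ (here refl)
    select-split (b ∷ m) (y ∷ S) e (there x∈) with select-split m S (suc-injective e) x∈ | b
    ... | inj₁ x∈m | true  = inj₁ (there x∈m)
    ... | inj₁ x∈m | false = inj₁ x∈m
    ... | inj₂ x∈m | true  = inj₂ x∈m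
    ... | inj₂ x∈m | false = inj₂ (there x∈m)

    select-disjoint : ∀ m {S : List A} → Unique S → ∀ {x} → x ∈ select m S → x ∉ select (map not m) S
    select-disjoint (true  ∷ m) {y ∷ S} (y∉ ∷ _)  (here refl) x∈′ = All¬⇒¬Any y∉ (select-⊆ (map not m) S x∈′)
    select-disjoint (true  ∷ m) {y ∷ S} (_ ∷ !S)  (there x∈)  x∈′ = select-disjoint m !S x∈ x∈′
    select-disjoint (false ∷ m) {y ∷ S} (y∉ ∷ _)  x∈ (here refl)  = All¬⇒¬Any y∉ (select-⊆ m S x∈)
    select-disjoint (false ∷ m) {y ∷ S} (_ ∷ !S)  x∈ (there x∈′)  = select-disjoint m !S x∈ x∈′

    select-AllPairs : ∀ {R : A → A → Set} m {S} → AllPairs R S → AllPairs R (select m S)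
    select-AllPairs (true  ∷ m) {y ∷ S} (y~S ∷ S~) =
      All.tabulate (All.lookup y~S ∘ select-⊆ m S) ∷ select-AllPairs m S~
    select-AllPairs (false ∷ m) {y ∷ S} (_ ∷ S~)   = select-AllPairs m S~
    select-AllPairs (true  ∷ m) {[]}    _          = []
    select-AllPairs (false ∷ m) {[]}    _          = []
    select-AllPairs []          {S}     _          = []

    select-injective : ∀ {S : List A} m m′ → Unique S → length m ≡ length S → length m′ ≡ length S →
                       select m S ≡ select m′ S → m ≡ m′
    select-injective {[]}    []          []           _         _ _ _ = refl
    select-injective {x ∷ S} (true ∷ m)  (true ∷ m′)  (_ ∷ !S)  l l′ e =
      cong (true ∷_) (select-injective m m′ !S (suc-injective l) (suc-injective l′) (∷-injectiveʳ e))
    select-injective {x ∷ S} (false ∷ m) (false ∷ m′) (_ ∷ !S)  l l′ e =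
      cong (false ∷_) (select-injective m m′ !S (suc-injective l) (suc-injective l′) e)
    select-injective {x ∷ S} (true ∷ m)  (false ∷ m′) (x∉ ∷ _) _ _ e =
      ⊥-elim (All¬⇒¬Any x∉ (select-⊆ m′ S (subst (x ∈_) e (here refl))))
    select-injective {x ∷ S} (false ∷ m) (true ∷ m′)  (x∉ ∷ _) _ _ e =
      ⊥-elim (All¬⇒¬Any x∉ (select-⊆ m S (subst (x ∈_) (sym e) (here refl))))

    select≡filter : ∀ {P : A → Set} (P? : Decidable P) S → select (map (does ∘ P?) S) S ≡ filter P? S
    select≡filter P? []      = refl
    select≡filter P? (x ∷ S) with does (P? x)
    ... | true  = cong (x ∷_) (select≡filter P? S)
    ... | false = select≡filter P? S

    length-select≤ : ∀ m (S : List A) → length (select m S) ≤ length S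
    length-select≤ (true  ∷ m) (x ∷ S) = s≤s (length-select≤ m S)
    length-select≤ (false ∷ m) (x ∷ S) = m≤n⇒m≤1+n (length-select≤ m S)
    length-select≤ (true  ∷ m) []      = z≤n
    length-select≤ (false ∷ m) []      = z≤n
    length-select≤ []          S       = z≤n

  masks-complete : ∀ m → m ∈ masks (length m)
  masks-complete []          = here refl
  masks-complete (true  ∷ m) = ∈-++⁺ˡ (∈-map⁺ (true ∷_) (masks-complete m))
  masks-complete (false ∷ m) = ∈-++⁺ʳ (map (true ∷_) (masks (length m))) (∈-map⁺ (false ∷_) (masks-complete m))

  masks-length : ∀ n {m} → m ∈ masks n → length m ≡ n
  masks-length zero    (here refl) = refl
  masks-length (suc n) m∈ with ∈-++⁻ (map (true ∷_) (masks n)) m∈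
  ... | inj₁ m∈t with ∈-map⁻ (true ∷_) m∈t
  ...   | _ , m′∈ , refl = cong suc (masks-length n m′∈)
  masks-length (suc n) m∈ | inj₂ m∈f with ∈-map⁻ (false ∷_) m∈f
  ...   | _ , m′∈ , refl = cong suc (masks-length n m′∈)

  masks-unique : ∀ n → Unique (masks n)
  masks-unique zero    = [] ∷ []
  masks-unique (suc n) = Unique.++⁺ (Unique.map⁺ ∷-injectiveʳ (masks-unique n)) (Unique.map⁺ ∷-injectiveʳ (masks-unique n))
    λ (t∈ , f∈) → case ∈-map⁻ (true ∷_) t∈ , ∈-map⁻ (false ∷_) f∈ of λ { ((_ , _ , refl) , (_ , _ , ())) }

  -- binomialSum n g = Σ_{d+r=n} C(n,d) · g d r
  binomialSum : ℕ → (ℕ → ℕ → ℕ) → ℕ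
  binomialSum zero    g = g 0 0
  binomialSum (suc n) g = binomialSum n (λ d r → g (suc d) r) + binomialSum n (λ d r → g d (suc r))

  ifPos : ℕ → ℕ → ℕ
  ifPos zero    _ = 0
  ifPos (suc _) x = x

  sum-masks : ∀ {A : Set} (S : List A) (h : List Bool → ℕ) g →
              (∀ m → h m ≡ g (length (select m S)) (length (select (map not m) S))) →
              sum (map h (masks (length S))) ≡ binomialSum (length S) g
  sum-masks []      h g h≡ = trans (+-identityʳ (h [])) (h≡ [])
  sum-masks (x ∷ S) h g h≡ = begin
    sum (map h (map (true ∷_) M ++ map (false ∷_) M))
      ≡⟨ cong sum (map-++ h (map (true ∷_) M) (map (false ∷_) M)) ⟩
    sum (map h (map (true ∷_) M) ++ map h (map (false ∷_) M))
      ≡⟨ sum-++ (map h (map (true ∷_) M)) (map h (map (false ∷_) M)) ⟩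
    sum (map h (map (true ∷_) M)) + sum (map h (map (false ∷_) M))
      ≡⟨ cong₂ _+_ (cong sum (map-∘ M)) (cong sum (map-∘ M)) ⟨
    sum (map (h ∘ (true ∷_)) M) + sum (map (h ∘ (false ∷_)) M)
      ≡⟨ cong₂ _+_ (sum-masks S _ _ (h≡ ∘ (true ∷_))) (sum-masks S _ _ (h≡ ∘ (false ∷_))) ⟩
    binomialSum (length (x ∷ S)) g ∎
    where
      open ≡-Reasoning
      M : List (List Bool)
      M = masks (length S)

  extendFirst : ℕ → List ℕ → List (List ℕ) → List (List ℕ)
  extendFirst s₀ D []       = []
  extendFirst s₀ D (H ∷ Hs) = (s₀ ∷ D ++ H) ∷ Hs

  -- forms k S j lists the avoiding cycle forms on the ascending word S with j cycles (the fuel k must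
  -- be at least length S).  For S = s₀ s₁ S′ a mask picks the letters D written between s₀ and s₁, in
  -- decreasing order, and the branches say whether the first cycle ends before s₁, right after s₁, or
  -- continues past it.
  mutual
    forms : ℕ → List ℕ → ℕ → List (List (List ℕ))
    forms k       []            zero    = [ [] ]
    forms k       []            (suc j) = []
    forms k       (_ ∷ [])      j       = []
    forms zero    (_ ∷ _ ∷ _)   j       = []
    forms (suc k) (s₀ ∷ s₁ ∷ S) j       =
      concatMap (λ m → branches k s₀ s₁ (reverse (select m S)) (select (map not m) S) j) (masks (length S))

    branches : ℕ → ℕ → ℕ → List ℕ → List ℕ → ℕ → List (List (List ℕ))
    branches k s₀ s₁ D R j = closingBefore k s₀ s₁ D R j ++ closingAt k s₀ s₁ D R j ++ continuing k s₀ s₁ D R j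

    closingBefore : ℕ → ℕ → ℕ → List ℕ → List ℕ → ℕ → List (List (List ℕ))
    closingBefore k s₀ s₁ []      R j       = []
    closingBefore k s₀ s₁ (d ∷ D) R zero    = []
    closingBefore k s₀ s₁ (d ∷ D) R (suc j) = map ((s₀ ∷ d ∷ D) ∷_) (forms k (s₁ ∷ R) j)

    closingAt : ℕ → ℕ → ℕ → List ℕ → List ℕ → ℕ → List (List (List ℕ))
    closingAt k s₀ s₁ D R zero    = []
    closingAt k s₀ s₁ D R (suc j) = map ((s₀ ∷ D ++ [ s₁ ]) ∷_) (forms k R j)

    continuing : ℕ → ℕ → ℕ → List ℕ → List ℕ → ℕ → List (List (List ℕ))
    continuing k s₀ s₁ D R j = map (extendFirst s₀ D) (forms k (s₁ ∷ R) j)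

  mutual
    #forms : ℕ → ℕ → ℕ → ℕ
    #forms k       zero          zero    = 1
    #forms k       zero          (suc j) = 0
    #forms k       (suc zero)    j       = 0
    #forms zero    (suc (suc n)) j       = 0
    #forms (suc k) (suc (suc n)) j       = binomialSum n (branchCount k j)

    branchCount : ℕ → ℕ → ℕ → ℕ → ℕ
    branchCount k j d r = ifPos d (ifPos j (#forms k (suc r) (j ∸ 1))) + ifPos j (#forms k r (j ∸ 1)) + #forms k (suc r) j

  mutual
    length-forms : ∀ k S j → length (forms k S j) ≡ #forms k (length S) j
    length-forms k       []            zero    = refl
    length-forms k       []            (suc j) = refl
    length-forms k       (_ ∷ [])      j       = refl
    length-forms zero    (_ ∷ _ ∷ _)   j       = refl
    length-forms (suc k) (s₀ ∷ s₁ ∷ S) j       =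
      trans (length-concatMap branch (masks (length S)))
            (sum-masks S (length ∘ branch) (branchCount k j) λ m →
              trans (length-branches k s₀ s₁ (reverse (select m S)) (select (map not m) S) j)
                    (cong (λ d → branchCount k j d (length (select (map not m) S))) (length-reverse (select m S))))
      where
        branch : List Bool → List (List (List ℕ))
        branch m = branches k s₀ s₁ (reverse (select m S)) (select (map not m) S) j

    length-branches : ∀ k s₀ s₁ D R j → length (branches k s₀ s₁ D R j) ≡ branchCount k j (length D) (length R)
    length-branches k s₀ s₁ D R j = begin
      length (closingBefore k s₀ s₁ D R j ++ closingAt k s₀ s₁ D R j ++ continuing k s₀ s₁ D R j)
        ≡⟨ length-++ (closingBefore k s₀ s₁ D R j) ⟩
      length (closingBefore k s₀ s₁ D R j) + length (closingAt k s₀ s₁ D R j ++ continuing k s₀ s₁ D R j)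
        ≡⟨ cong (length (closingBefore k s₀ s₁ D R j) +_) (length-++ (closingAt k s₀ s₁ D R j)) ⟩
      length (closingBefore k s₀ s₁ D R j) + (length (closingAt k s₀ s₁ D R j) + length (continuing k s₀ s₁ D R j))
        ≡⟨ +-assoc (length (closingBefore k s₀ s₁ D R j)) _ _ ⟨
      length (closingBefore k s₀ s₁ D R j) + length (closingAt k s₀ s₁ D R j) + length (continuing k s₀ s₁ D R j)
        ≡⟨ cong₂ _+_ (cong₂ _+_ (length-closingBefore D j) (length-closingAt j)) length-continuing ⟩
      _ ∎
      where
        open ≡-Reasoning
        length-closingBefore : ∀ D j → length (closingBefore k s₀ s₁ D R j) ≡ ifPos (length D) (ifPos j (#forms k (suc (length R)) (j ∸ 1)))
        length-closingBefore []      j       = refl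
        length-closingBefore (_ ∷ _) zero    = refl
        length-closingBefore (d ∷ D) (suc j) = trans (length-map _ (forms k (s₁ ∷ R) j)) (length-forms k (s₁ ∷ R) j)
        length-closingAt : ∀ j → length (closingAt k s₀ s₁ D R j) ≡ ifPos j (#forms k (length R) (j ∸ 1))
        length-closingAt zero    = refl
        length-closingAt (suc j) = trans (length-map _ (forms k R j)) (length-forms k R j)
        length-continuing : length (continuing k s₀ s₁ D R j) ≡ #forms k (suc (length R)) j
        length-continuing = trans (length-map _ (forms k (s₁ ∷ R) j)) (length-forms k (s₁ ∷ R) j)

  record Split (s₀ s₁ : ℕ) (S D R : List ℕ) : Set where
    field
      sorted     : Ascending (s₀ ∷ s₁ ∷ S)
      D⊆S        : D ⊆ S
      R⊆S        : R ⊆ S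
      S⊆D∪R      : ∀ {x} → x ∈ S → x ∈ D ⊎ x ∈ R
      D∩R≡∅      : ∀ {x} → x ∈ D → x ∉ R
      descending : Descending D
      ascending  : Ascending R

    s₀<s₁S : All (s₀ <_) (s₁ ∷ S)
    s₀<s₁S = AllPairs.head sorted

    s₁<S : All (s₁ <_) S
    s₁<S = AllPairs.head (AllPairs.tail sorted)

    s₁<D : All (s₁ <_) D
    s₁<D = All.tabulate (All.lookup s₁<S ∘ D⊆S)

    s₁<R : All (s₁ <_) R
    s₁<R = All.tabulate (All.lookup s₁<S ∘ R⊆S)

    ascending₁ : Ascending (s₁ ∷ R)
    ascending₁ = s₁<R ∷ ascending

  mask-split : ∀ {s₀ s₁ S} m → Ascending (s₀ ∷ s₁ ∷ S) → length m ≡ length S →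
               Split s₀ s₁ S (reverse (select m S)) (select (map not m) S)
  mask-split {S = S} m sorted m≡S = record
    { sorted     = sorted
    ; D⊆S        = select-⊆ m S ∘ reverse⁻
    ; R⊆S        = select-⊆ (map not m) S
    ; S⊆D∪R      = Sum.map₁ reverse⁺ ∘ select-split m S m≡S
    ; D∩R≡∅      = select-disjoint m (Ascending⇒Unique S↗) ∘ reverse⁻
    ; descending = AllPairs-reverse (select-AllPairs m S↗)
    ; ascending  = select-AllPairs (map not m) S↗
    }
    where
      S↗ : Ascending S
      S↗ = AllPairs.tail (AllPairs.tail sorted)

  module _ {s₀ s₁ S D R} (split : Split s₀ s₁ S D R) where

    open Split split

    prepend-arrangement : ∀ rest → AvoidingArrangement (s₁ ∷ R) (s₁ ∷ rest) →
                          AvoidingArrangement (s₀ ∷ s₁ ∷ S) (s₀ ∷ D ++ s₁ ∷ rest)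
    prepend-arrangement rest W = record
      { unique   = All.tabulate (λ x∈ s₀≡x → <-irrefl s₀≡x (All.lookup s₀<DW x∈))
                 ∷ Unique.++⁺ (Descending⇒Unique descending) unique D∩W≡∅
      ; sound    = sound′
      ; complete = complete′
      ; avoids   = avoids23-1-prefix⁺ s₀ D s₁ rest s₀<DW descending s₁<D avoids
      }
      where
        open AvoidingArrangement W
        W⊆S : ∀ {x} → x ∈ s₁ ∷ rest → x ∈ s₁ ∷ S
        W⊆S x∈ with sound x∈
        ... | here refl  = here refl
        ... | there x∈R = there (R⊆S x∈R)
        s₀<DW : All (s₀ <_) (D ++ s₁ ∷ rest)
        s₀<DW = All.tabulate λ x∈ → case ∈-++⁻ D x∈ of λ where
          (inj₁ x∈D) → All.lookup s₀<s₁S (there (D⊆S x∈D))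
          (inj₂ x∈W) → All.lookup s₀<s₁S (W⊆S x∈W)
        D∩W≡∅ : Disjoint D (s₁ ∷ rest)
        D∩W≡∅ (x∈D , x∈W) with sound x∈W
        ... | here refl  = <-irrefl refl (All.lookup s₁<D x∈D)
        ... | there x∈R = D∩R≡∅ x∈D x∈R
        sound′ : s₀ ∷ D ++ s₁ ∷ rest ⊆ s₀ ∷ s₁ ∷ S
        sound′ (here refl) = here refl
        sound′ (there x∈) with ∈-++⁻ D x∈
        ... | inj₁ x∈D = there (there (D⊆S x∈D))
        ... | inj₂ x∈W = there (W⊆S x∈W)
        complete′ : s₀ ∷ s₁ ∷ S ⊆ s₀ ∷ D ++ s₁ ∷ rest
        complete′ (here refl)         = here refl
        complete′ (there (here refl)) = there (∈-++⁺ʳ D (here refl))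
        complete′ (there (there x∈S)) with S⊆D∪R x∈S
        ... | inj₁ x∈D = there (∈-++⁺ˡ x∈D)
        ... | inj₂ x∈R = there (∈-++⁺ʳ D (complete (there x∈R)))

  arrangement-prefix : ∀ {s₀ s₁ S} D rest → Ascending (s₀ ∷ s₁ ∷ S) →
                       AvoidingArrangement (s₀ ∷ s₁ ∷ S) (s₀ ∷ D ++ s₁ ∷ rest) →
                       D ⊆ S × Descending D × T (avoids23-1 (s₁ ∷ rest))
  arrangement-prefix {s₀} {s₁} {S} D rest sorted word =
    D⊆S , avoids23-1-prefix⁻ s₀ D s₁ rest s₀<DW (Unique-++⁻ˡ D !DW) s₁<D avoids
    where
      open AvoidingArrangement word
      s₀∉DW : ∀ {x} → x ∈ D ++ s₁ ∷ rest → s₀ ≢ x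
      s₀∉DW = All.lookup (AllPairs.head unique)
      !DW : Unique (D ++ s₁ ∷ rest)
      !DW = AllPairs.tail unique
      D⊆S : D ⊆ S
      D⊆S x∈D with sound (there (∈-++⁺ˡ x∈D))
      ... | here refl         = ⊥-elim (s₀∉DW (∈-++⁺ˡ x∈D) refl)
      ... | there (here refl) = ⊥-elim (Unique-++⇒∉ D !DW x∈D (here refl))
      ... | there (there x∈S) = x∈S
      s₀<DW : All (s₀ <_) (D ++ s₁ ∷ rest)
      s₀<DW = All.tabulate λ x∈ → case sound (there x∈) of λ where
        (here refl)  → ⊥-elim (s₀∉DW x∈ refl)
        (there x∈S) → All.lookup (AllPairs.head sorted) x∈S
      s₁<D : All (s₁ <_) D
      s₁<D = All.tabulate (All.lookup (AllPairs.head (AllPairs.tail sorted)) ∘ D⊆S)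

  descending-mask : ∀ {S} D → Ascending S → D ⊆ S → Descending D → reverse (select (map (does ∘ (_∈? D)) S) S) ≡ D
  descending-mask {S} D S↗ D⊆S D↘ = begin
    reverse (select (map (does ∘ (_∈? D)) S) S) ≡⟨ cong reverse (select≡filter (_∈? D) S) ⟩
    reverse (filter (_∈? D) S)                  ≡⟨ cong reverse (ascending-⊆⊇⇒≡
                                                     (AllPairs.filter⁺ (_∈? D) S↗) (AllPairs-reverse D↘)
                                                     (reverse⁺ ∘ proj₂ ∘ ∈-filter⁻ (_∈? D) {xs = S})
                                                     (λ x∈ → ∈-filter⁺ (_∈? D) (D⊆S (reverse⁻ x∈)) (reverse⁻ x∈))) ⟩
    reverse (reverse D)                         ≡⟨ reverse-involutive D ⟩
    D                                           ∎
    where open ≡-Reasoning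

  arrangement-split : ∀ {s₀ s₁ S} D rest → Ascending (s₀ ∷ s₁ ∷ S) →
                      AvoidingArrangement (s₀ ∷ s₁ ∷ S) (s₀ ∷ D ++ s₁ ∷ rest) →
                      ∃ λ m → m ∈ masks (length S) × reverse (select m S) ≡ D ×
                              AvoidingArrangement (s₁ ∷ select (map not m) S) (s₁ ∷ rest)
  arrangement-split {s₀} {s₁} {S} D rest sorted word =
    m , subst (λ l → m ∈ masks l) (length-map _ S) (masks-complete m) , D≡ , record
      { unique   = Unique-++⁻ʳ (s₀ ∷ D) unique
      ; sound    = sound′
      ; complete = complete′
      ; avoids   = avoids′
      }
    where
      open AvoidingArrangement word
      m : List Bool
      m = map (does ∘ (_∈? D)) S
      prefix : D ⊆ S × Descending D × T (avoids23-1 (s₁ ∷ rest))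
      prefix = arrangement-prefix D rest sorted word
      D≡ : reverse (select m S) ≡ D
      D≡ = descending-mask D (AllPairs.tail (AllPairs.tail sorted)) (proj₁ prefix) (proj₁ (proj₂ prefix))
      avoids′ : T (avoids23-1 (s₁ ∷ rest))
      avoids′ = proj₂ (proj₂ prefix)
      open Split (subst (λ D′ → Split s₀ s₁ S D′ (select (map not m) S)) D≡ (mask-split m sorted (length-map _ S)))
        using (S⊆D∪R; D∩R≡∅; R⊆S)
      sound′ : s₁ ∷ rest ⊆ s₁ ∷ select (map not m) S
      sound′ x∈W with sound (there (∈-++⁺ʳ D x∈W))
      ... | here refl         = ⊥-elim (All.lookup (AllPairs.head unique) (∈-++⁺ʳ D x∈W) refl)
      ... | there (here refl) = here refl
      ... | there (there x∈S) with S⊆D∪R x∈S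
      ...   | inj₁ x∈D = ⊥-elim (Unique-++⇒∉ D (AllPairs.tail unique) x∈D x∈W)
      ...   | inj₂ x∈R = there x∈R
      complete′ : s₁ ∷ select (map not m) S ⊆ s₁ ∷ rest
      complete′ (here refl) = here refl
      complete′ (there x∈R) with complete (there (there (R⊆S x∈R)))
      ... | here refl = ⊥-elim (<-irrefl refl (All.lookup (AllPairs.head sorted) (there (R⊆S x∈R))))
      ... | there x∈DW with ∈-++⁻ D x∈DW
      ...   | inj₁ x∈D = ⊥-elim (D∩R≡∅ x∈D x∈R)
      ...   | inj₂ x∈W = x∈W

  AtLeastTwo-∷-++-∷ : ∀ {A : Set} (x : A) ys y zs → AtLeastTwo (x ∷ ys ++ y ∷ zs)
  AtLeastTwo-∷-++-∷ x []      y zs = _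
  AtLeastTwo-∷-++-∷ x (_ ∷ _) y zs = _

  AtLeastTwo-∷⁻ : ∀ {A : Set} {x : A} {xs} → AtLeastTwo (x ∷ xs) → ∃₂ λ y ys → xs ≡ y ∷ ys
  AtLeastTwo-∷⁻ {xs = y ∷ ys} _ = y , ys , refl

  arrangement-head-min : ∀ {s S w} → All (s <_) S → AvoidingArrangement (s ∷ S) (s ∷ w) → All (s <_) w
  arrangement-head-min {s} {S} {w} s<S word = All.tabulate λ x∈w → case-on (sound (there x∈w)) x∈w
    where
      open AvoidingArrangement word
      case-on : ∀ {x} → x ∈ s ∷ S → x ∈ w → s < x
      case-on (here refl) x∈w = ⊥-elim (All.lookup (AllPairs.head unique) x∈w refl)
      case-on (there x∈S) _   = All.lookup s<S x∈S

  module _ {s S} (s<S : All (s <_) S) where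

    cons-arrangement : ∀ {w} → AvoidingArrangement S w → AvoidingArrangement (s ∷ S) (s ∷ w)
    cons-arrangement word = record
      { unique   = All.tabulate (λ x∈w s≡x → <-irrefl s≡x (All.lookup s<S (sound x∈w))) ∷ unique
      ; sound    = λ { (here refl) → here refl ; (there x∈w) → there (sound x∈w) }
      ; complete = λ { (here refl) → here refl ; (there x∈S) → there (complete x∈S) }
      ; avoids   = subst T (sym (avoids23-1-∷-min s _ (All.tabulate (All.lookup s<S ∘ sound)))) avoids
      }
      where open AvoidingArrangement word

    uncons-arrangement : ∀ {w} → AvoidingArrangement (s ∷ S) (s ∷ w) → AvoidingArrangement S w
    uncons-arrangement {w} word = record
      { unique   = AllPairs.tail unique
      ; sound    = sound′
      ; complete = complete′
      ; avoids   = subst T (avoids23-1-∷-min s w (arrangement-head-min s<S word)) avoids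
      }
      where
        open AvoidingArrangement word
        sound′ : w ⊆ S
        sound′ x∈w with sound (there x∈w)
        ... | here refl  = ⊥-elim (All.lookup (AllPairs.head unique) x∈w refl)
        ... | there x∈S = x∈S
        complete′ : S ⊆ w
        complete′ x∈S with complete (there x∈S)
        ... | here refl  = ⊥-elim (<-irrefl refl (All.lookup s<S x∈S))
        ... | there x∈w = x∈w

  form-head : ∀ {s S j H} → Ascending (s ∷ S) → AvoidingCycleForm (s ∷ S) j H → ∃₂ λ r H′ → H ≡ (s ∷ r) ∷ H′
  form-head {H = H} sorted form = StandardOrder-head <-asym H sorted (complete (here refl)) sound ordered
    where open AvoidingCycleForm form

  module _ {s₀ s₁ S D R} (split : Split s₀ s₁ S D R) where

    open Split split

    extend-form : ∀ {j} C F′ rest → AtLeastTwo (s₀ ∷ C) → C ++ concat F′ ≡ D ++ s₁ ∷ rest →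
                  StandardOrder _<_ F′ → All AtLeastTwo F′ → suc (length F′) ≡ j →
                  AvoidingArrangement (s₁ ∷ R) (s₁ ∷ rest) → AvoidingCycleForm (s₀ ∷ s₁ ∷ S) j ((s₀ ∷ C) ∷ F′)
    extend-form C F′ rest two C++F′≡ ordered twos #cycles W = record
      { nontrivial  = two ∷ twos
      ; ordered     = arrangement-head-min s₀<s₁S word , ordered
      ; arrangement = word
      ; #cycles     = #cycles
      }
      where
        word : AvoidingArrangement (s₀ ∷ s₁ ∷ S) (s₀ ∷ C ++ concat F′)
        word = subst (AvoidingArrangement _ ∘ (s₀ ∷_)) (sym C++F′≡) (prepend-arrangement split rest W)

  mutual
    forms-sound : ∀ k S j {F} → Ascending S → F ∈ forms k S j → AvoidingCycleForm S j F
    forms-sound k [] zero _ (here refl) = record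
      { nontrivial  = []
      ; ordered     = _
      ; arrangement = record { unique = [] ; sound = λ () ; complete = λ () ; avoids = _ }
      ; #cycles     = refl
      }
    forms-sound (suc k) (s₀ ∷ s₁ ∷ S) j sorted F∈
      with ∈-concat⁻′ (map (λ m → branches k s₀ s₁ (reverse (select m S)) (select (map not m) S) j) (masks (length S))) F∈
    ... | _ , F∈b , b∈ with ∈-map⁻ _ b∈
    ... | m , m∈ , refl = branches-sound k (mask-split m sorted (masks-length _ m∈)) j F∈b

    branches-sound : ∀ k {s₀ s₁ S D R} → Split s₀ s₁ S D R → ∀ j {F} →
                     F ∈ branches k s₀ s₁ D R j → AvoidingCycleForm (s₀ ∷ s₁ ∷ S) j F
    branches-sound k {s₀} {s₁} {S} {D} {R} split j F∈ with ∈-++⁻ (closingBefore k s₀ s₁ D R j) F∈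
    ... | inj₁ F∈b = closingBefore-sound k split j F∈b
    ... | inj₂ F∈′ with ∈-++⁻ (closingAt k s₀ s₁ D R j) F∈′
    ...   | inj₁ F∈a = closingAt-sound k split j F∈a
    ...   | inj₂ F∈c = continuing-sound k split j F∈c

    closingBefore-sound : ∀ k {s₀ s₁ S D R} → Split s₀ s₁ S D R → ∀ j {F} →
                          F ∈ closingBefore k s₀ s₁ D R j → AvoidingCycleForm (s₀ ∷ s₁ ∷ S) j F
    closingBefore-sound k {s₀} {s₁} {D = d ∷ D} {R} split (suc j) F∈ with ∈-map⁻ ((s₀ ∷ d ∷ D) ∷_) F∈
    ... | H , H∈ , refl with forms-sound k (s₁ ∷ R) j (Split.ascending₁ split) H∈
    ... | form with form-head (Split.ascending₁ split) form
    ... | r , H′ , refl =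
      extend-form split (d ∷ D) _ (r ++ concat H′) _ refl ordered nontrivial (cong suc #cycles) arrangement
      where open AvoidingCycleForm form

    closingAt-sound : ∀ k {s₀ s₁ S D R} → Split s₀ s₁ S D R → ∀ j {F} →
                      F ∈ closingAt k s₀ s₁ D R j → AvoidingCycleForm (s₀ ∷ s₁ ∷ S) j F
    closingAt-sound k {s₀} {s₁} {D = D} {R} split (suc j) F∈ with ∈-map⁻ ((s₀ ∷ D ++ [ s₁ ]) ∷_) F∈
    ... | G , G∈ , refl with forms-sound k R j (Split.ascending split) G∈
    ... | form = extend-form split (D ++ [ s₁ ]) G (concat G) (AtLeastTwo-∷-++-∷ s₀ D s₁ [])
                   (++-assoc D [ s₁ ] (concat G)) ordered nontrivial (cong suc #cycles)
                   (cons-arrangement (Split.s₁<R split) arrangement)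
      where open AvoidingCycleForm form

    continuing-sound : ∀ k {s₀ s₁ S D R} → Split s₀ s₁ S D R → ∀ j {F} →
                       F ∈ continuing k s₀ s₁ D R j → AvoidingCycleForm (s₀ ∷ s₁ ∷ S) j F
    continuing-sound k {s₀} {s₁} {D = D} {R} split j F∈ with ∈-map⁻ (extendFirst s₀ D) F∈
    ... | H , H∈ , refl with forms-sound k (s₁ ∷ R) j (Split.ascending₁ split) H∈
    ... | form with form-head (Split.ascending₁ split) form
    ... | T , H′ , refl =
      extend-form split (D ++ s₁ ∷ T) H′ (T ++ concat H′) (AtLeastTwo-∷-++-∷ s₀ D s₁ T)
                  (++-assoc D (s₁ ∷ T) (concat H′)) (proj₂ ordered) (All.tail nontrivial) #cycles arrangement
      where open AvoidingCycleForm form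

  data FirstCycle (s₀ s₁ : ℕ) : List (List ℕ) → Set where
    closes-before : ∀ d D r F → FirstCycle s₀ s₁ ((s₀ ∷ d ∷ D) ∷ (s₁ ∷ r) ∷ F)
    closes-at     : ∀ D F     → FirstCycle s₀ s₁ ((s₀ ∷ D ++ [ s₁ ]) ∷ F)
    continues     : ∀ D t T F → FirstCycle s₀ s₁ ((s₀ ∷ D ++ s₁ ∷ t ∷ T) ∷ F)

  second-cycle-head : ∀ {s₀ s₁ S j r F₁} → Ascending (s₀ ∷ s₁ ∷ S) → s₁ ∉ r →
                      AvoidingCycleForm (s₀ ∷ s₁ ∷ S) j ((s₀ ∷ r) ∷ F₁) → ∃₂ λ r₂ F₂ → F₁ ≡ (s₁ ∷ r₂) ∷ F₂
  second-cycle-head {s₀} {s₁} {S} {r = r} {F₁} sorted s₁∉r form =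
    StandardOrder-head <-asym F₁ (AllPairs.tail sorted) s₁∈F₁ F₁⊆ (proj₂ ordered)
    where
      open AvoidingCycleForm form
      s₁∈F₁ : s₁ ∈ concat F₁
      s₁∈F₁ with complete (there (here refl))
      ... | here s₁≡s₀ = ⊥-elim (<-irrefl (sym s₁≡s₀) (All.head (AllPairs.head sorted)))
      ... | there s₁∈ with ∈-++⁻ r s₁∈
      ...   | inj₁ s₁∈r  = ⊥-elim (s₁∉r s₁∈r)
      ...   | inj₂ s₁∈F₁ = s₁∈F₁
      F₁⊆ : concat F₁ ⊆ s₁ ∷ S
      F₁⊆ x∈ with sound (there (∈-++⁺ʳ r x∈))
      ... | here refl  = ⊥-elim (<-irrefl refl (All.lookup (proj₁ ordered) (∈-++⁺ʳ r x∈)))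
      ... | there x∈S = x∈S

  first-cycle : ∀ {s₀ s₁ S j F} → Ascending (s₀ ∷ s₁ ∷ S) → AvoidingCycleForm (s₀ ∷ s₁ ∷ S) j F → FirstCycle s₀ s₁ F
  first-cycle {s₁ = s₁} sorted form with form-head sorted form
  ... | r , F₁ , refl with s₁ ∈? r
  ...   | yes s₁∈r with ∈-∃++ s₁∈r
  ...     | D , []    , refl = closes-at D F₁
  ...     | D , t ∷ T , refl = continues D t T F₁
  first-cycle sorted form | r , F₁ , refl | no s₁∉r
    with AtLeastTwo-∷⁻ (All.head (AvoidingCycleForm.nontrivial form)) | second-cycle-head sorted s₁∉r form
  ... | d , D , refl | r₂ , F₂ , refl = closes-before d D r₂ F₂

  branches⊆forms : ∀ k {s₀ s₁ S D} m → m ∈ masks (length S) → reverse (select m S) ≡ D →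
                   ∀ {j} → branches k s₀ s₁ D (select (map not m) S) j ⊆ forms (suc k) (s₀ ∷ s₁ ∷ S) j
  branches⊆forms k {s₀} {s₁} {S} m m∈ refl {j} F∈ =
    ∈-concat⁺′ F∈ (∈-map⁺ (λ m → branches k s₀ s₁ (reverse (select m S)) (select (map not m) S) j) m∈)

  mutual
    forms-complete : ∀ k S j {F} → Ascending S → length S ≤ k → AvoidingCycleForm S j F → F ∈ forms k S j
    forms-complete k [] j {[]} _ _ form with AvoidingCycleForm.#cycles form
    ... | refl = here refl
    forms-complete k [] j {[] ∷ _} _ _ form = ⊥-elim (AvoidingCycleForm.ordered form)
    forms-complete k [] j {(_ ∷ _) ∷ _} _ _ form with AvoidingCycleForm.sound form (here refl)
    ... | ()
    forms-complete k (s ∷ []) j sorted _ form with form-head sorted form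
    ... | r , _ , refl with AtLeastTwo-∷⁻ (All.head (AvoidingCycleForm.nontrivial form))
    ...   | _ , _ , refl with AvoidingCycleForm.sound form (there (here refl))
    ...     | here refl = ⊥-elim (All.head (AllPairs.head (AvoidingCycleForm.unique form)) refl)
    forms-complete (suc k) (s₀ ∷ s₁ ∷ S) j sorted (s≤s fuel) form with first-cycle sorted form
    ... | closes-before _ _ _ _ = closes-before-complete k sorted fuel form
    ... | closes-at _ _         = closes-at-complete k sorted fuel form
    ... | continues _ _ _ _     = continues-complete k sorted fuel form

    closes-before-complete : ∀ k {s₀ s₁ S j d D r F₂} → Ascending (s₀ ∷ s₁ ∷ S) → suc (length S) ≤ k →
                             AvoidingCycleForm (s₀ ∷ s₁ ∷ S) j ((s₀ ∷ d ∷ D) ∷ (s₁ ∷ r) ∷ F₂) →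
                             (s₀ ∷ d ∷ D) ∷ (s₁ ∷ r) ∷ F₂ ∈ forms (suc k) (s₀ ∷ s₁ ∷ S) j
    closes-before-complete k {s₀} {s₁} {S} {j} {d} {D} {r} {F₂} sorted fuel form
      with arrangement-split (d ∷ D) (r ++ concat F₂) sorted (AvoidingCycleForm.arrangement form)
    ... | m , m∈ , D≡ , W = branches⊆forms k m m∈ D≡
      (∈-++⁺ˡ (subst (λ j → _ ∈ closingBefore k s₀ s₁ (d ∷ D) R j) #cycles (∈-map⁺ ((s₀ ∷ d ∷ D) ∷_) H∈)))
      where
        open AvoidingCycleForm form
        open Split (mask-split m sorted (masks-length _ m∈))
        R : List ℕ
        R = select (map not m) S
        H∈ : (s₁ ∷ r) ∷ F₂ ∈ forms k (s₁ ∷ R) (length ((s₁ ∷ r) ∷ F₂))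
        H∈ = forms-complete k (s₁ ∷ R) _ ascending₁ (≤-trans (s≤s (length-select≤ (map not m) S)) fuel) record
          { nontrivial = All.tail nontrivial ; ordered = proj₂ ordered ; arrangement = W ; #cycles = refl }

    closes-at-complete : ∀ k {s₀ s₁ S j D F₁} → Ascending (s₀ ∷ s₁ ∷ S) → suc (length S) ≤ k →
                         AvoidingCycleForm (s₀ ∷ s₁ ∷ S) j ((s₀ ∷ D ++ [ s₁ ]) ∷ F₁) →
                         (s₀ ∷ D ++ [ s₁ ]) ∷ F₁ ∈ forms (suc k) (s₀ ∷ s₁ ∷ S) j
    closes-at-complete k {s₀} {s₁} {S} {j} {D} {F₁} sorted fuel form
      with arrangement-split D (concat F₁) sorted
             (subst (AvoidingArrangement _ ∘ (s₀ ∷_)) (++-assoc D [ s₁ ] (concat F₁)) (AvoidingCycleForm.arrangement form))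
    ... | m , m∈ , D≡ , W = branches⊆forms k m m∈ D≡ (∈-++⁺ʳ (closingBefore k s₀ s₁ D R j)
      (∈-++⁺ˡ (subst (λ j → _ ∈ closingAt k s₀ s₁ D R j) #cycles (∈-map⁺ ((s₀ ∷ D ++ [ s₁ ]) ∷_) G∈))))
      where
        open AvoidingCycleForm form
        open Split (mask-split m sorted (masks-length _ m∈))
        R : List ℕ
        R = select (map not m) S
        G∈ : F₁ ∈ forms k R (length F₁)
        G∈ = forms-complete k R _ ascending (≤-trans (length-select≤ (map not m) S) (≤-trans (n≤1+n _) fuel)) record
          { nontrivial = All.tail nontrivial ; ordered = proj₂ ordered ; arrangement = uncons-arrangement s₁<R W
          ; #cycles = refl }

    continues-complete : ∀ k {s₀ s₁ S j D t T F₁} → Ascending (s₀ ∷ s₁ ∷ S) → suc (length S) ≤ k →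
                         AvoidingCycleForm (s₀ ∷ s₁ ∷ S) j ((s₀ ∷ D ++ s₁ ∷ t ∷ T) ∷ F₁) →
                         (s₀ ∷ D ++ s₁ ∷ t ∷ T) ∷ F₁ ∈ forms (suc k) (s₀ ∷ s₁ ∷ S) j
    continues-complete k {s₀} {s₁} {S} {j} {D} {t} {T} {F₁} sorted fuel form
      with arrangement-split D (t ∷ T ++ concat F₁) sorted
             (subst (AvoidingArrangement _ ∘ (s₀ ∷_)) (++-assoc D (s₁ ∷ t ∷ T) (concat F₁)) (AvoidingCycleForm.arrangement form))
    ... | m , m∈ , D≡ , W = branches⊆forms k m m∈ D≡ (∈-++⁺ʳ (closingBefore k s₀ s₁ D R j)
      (∈-++⁺ʳ (closingAt k s₀ s₁ D R j) (∈-map⁺ (extendFirst s₀ D) H∈)))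
      where
        open AvoidingCycleForm form
        open Split (mask-split m sorted (masks-length _ m∈))
        R : List ℕ
        R = select (map not m) S
        H∈ : (s₁ ∷ t ∷ T) ∷ F₁ ∈ forms k (s₁ ∷ R) j
        H∈ = forms-complete k (s₁ ∷ R) j ascending₁ (≤-trans (s≤s (length-select≤ (map not m) S)) fuel) record
          { nontrivial = _ ∷ All.tail nontrivial ; ordered = arrangement-head-min s₁<R W , proj₂ ordered
          ; arrangement = W ; #cycles = #cycles }

  extendFirst-injective : ∀ s₀ D {X Y} → extendFirst s₀ D X ≡ extendFirst s₀ D Y → X ≡ Y
  extendFirst-injective s₀ D {[]}    {[]}    _ = refl
  extendFirst-injective s₀ D {_ ∷ _} {_ ∷ _} e =
    cong₂ _∷_ (++-cancelˡ D _ _ (∷-injectiveʳ (∷-injectiveˡ e))) (∷-injectiveʳ e)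

  closingBefore-shape : ∀ k {s₀ s₁ S D R} → Split s₀ s₁ S D R → ∀ j {F} →
                        F ∈ closingBefore k s₀ s₁ D R j → ∃₂ λ r F′ → F ≡ (s₀ ∷ D) ∷ (s₁ ∷ r) ∷ F′
  closingBefore-shape k {s₀} {s₁} {D = d ∷ D} {R} split (suc j) F∈ with ∈-map⁻ ((s₀ ∷ d ∷ D) ∷_) F∈
  ... | H , H∈ , refl with form-head (Split.ascending₁ split) (forms-sound k (s₁ ∷ R) j (Split.ascending₁ split) H∈)
  ... | r , F′ , refl = r , F′ , refl

  closingAt-shape : ∀ k {s₀ s₁ D R} j {F} → F ∈ closingAt k s₀ s₁ D R j → ∃ λ F′ → F ≡ (s₀ ∷ D ++ [ s₁ ]) ∷ F′
  closingAt-shape k {s₀} {s₁} {D} (suc j) F∈ with ∈-map⁻ ((s₀ ∷ D ++ [ s₁ ]) ∷_) F∈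
  ... | G , _ , refl = G , refl

  continuing-shape : ∀ k {s₀ s₁ S D R} → Split s₀ s₁ S D R → ∀ j {F} →
                     F ∈ continuing k s₀ s₁ D R j → ∃₂ λ t T → ∃ λ F′ → F ≡ (s₀ ∷ D ++ s₁ ∷ t ∷ T) ∷ F′
  continuing-shape k {s₀} {s₁} {D = D} {R} split j F∈ with ∈-map⁻ (extendFirst s₀ D) F∈
  ... | H , H∈ , refl with forms-sound k (s₁ ∷ R) j (Split.ascending₁ split) H∈
  ... | form with form-head (Split.ascending₁ split) form
  ... | T , F′ , refl with AtLeastTwo-∷⁻ (All.head (AvoidingCycleForm.nontrivial form))
  ... | t , T′ , refl = t , T′ , F′ , refl

  branches-prefix : ∀ k {s₀ s₁ S D R} → Split s₀ s₁ S D R → ∀ j {F} →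
                    F ∈ branches k s₀ s₁ D R j → ∃ λ rest → concat F ≡ s₀ ∷ D ++ s₁ ∷ rest
  branches-prefix k {s₀} {s₁} {D = D} {R} split j F∈ with ∈-++⁻ (closingBefore k s₀ s₁ D R j) F∈
  ... | inj₁ F∈b with closingBefore-shape k split j F∈b
  ...   | r , F′ , refl = r ++ concat F′ , refl
  branches-prefix k {s₀} {s₁} {D = D} {R} split j F∈ | inj₂ F∈′ with ∈-++⁻ (closingAt k s₀ s₁ D R j) F∈′
  ... | inj₁ F∈a with closingAt-shape k j F∈a
  ...   | F′ , refl = concat F′ , cong (s₀ ∷_) (++-assoc D [ s₁ ] (concat F′))
  branches-prefix k {s₀} {s₁} {D = D} {R} split j F∈ | inj₂ F∈′ | inj₂ F∈c with continuing-shape k split j F∈c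
  ...   | t , T , F′ , refl = t ∷ T ++ concat F′ , cong (s₀ ∷_) (++-assoc D (s₁ ∷ t ∷ T) (concat F′))

  first-cycles-≡ : ∀ {c : ℕ} {C C′ F F′} → (c ∷ C) ∷ F ≡ (c ∷ C′) ∷ F′ → C ≡ C′
  first-cycles-≡ = ∷-injectiveʳ ∘ ∷-injectiveˡ

  mutual
    forms-unique : ∀ k S j → Ascending S → Unique (forms k S j)
    forms-unique k       []            zero    _      = [] ∷ []
    forms-unique k       []            (suc j) _      = []
    forms-unique k       (_ ∷ [])      j       _      = []
    forms-unique zero    (_ ∷ _ ∷ _)   j       _      = []
    forms-unique (suc k) (s₀ ∷ s₁ ∷ S) j       sorted =
      Unique-concatMap⁺ branch (masks-unique (length S)) (λ m∈ → branches-unique k (split m∈) j) disjoint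
      where
        branch : List Bool → List (List (List ℕ))
        branch m = branches k s₀ s₁ (reverse (select m S)) (select (map not m) S) j
        split : ∀ {m} → m ∈ masks (length S) → Split s₀ s₁ S (reverse (select m S)) (select (map not m) S)
        split {m} m∈ = mask-split m sorted (masks-length _ m∈)
        disjoint : ∀ {m m′} → m ∈ masks (length S) → m′ ∈ masks (length S) → m ≢ m′ → Disjoint (branch m) (branch m′)
        disjoint {m} {m′} m∈ m′∈ m≢m′ (F∈ , F∈′)
          with branches-prefix k (split m∈) j F∈ | branches-prefix k (split m′∈) j F∈′
        ... | _ , e | _ , e′ = m≢m′ (select-injective m m′ (Ascending⇒Unique (AllPairs.tail (AllPairs.tail sorted)))
                (masks-length _ m∈) (masks-length _ m′∈)
                (reverse-injective (prefix-unique _ _ (s₁∉ (split m∈)) (s₁∉ (split m′∈)) (∷-injectiveʳ (trans (sym e) e′)))))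
          where
            s₁∉ : ∀ {D R} → Split s₀ s₁ S D R → s₁ ∉ D
            s₁∉ split′ s₁∈D = <-irrefl refl (All.lookup (Split.s₁<D split′) s₁∈D)

    branches-unique : ∀ k {s₀ s₁ S D R} → Split s₀ s₁ S D R → ∀ j → Unique (branches k s₀ s₁ D R j)
    branches-unique k {s₀} {s₁} {S} {D} {R} split j =
      Unique.++⁺ (before-unique D j) (Unique.++⁺ (at-unique j) continuing-unique at∩continuing) before∩rest
      where
        open Split split
        before-unique : ∀ D j → Unique (closingBefore k s₀ s₁ D R j)
        before-unique []      j       = []
        before-unique (_ ∷ _) zero    = []
        before-unique (_ ∷ _) (suc j) = Unique.map⁺ ∷-injectiveʳ (forms-unique k (s₁ ∷ R) j ascending₁)
        at-unique : ∀ j → Unique (closingAt k s₀ s₁ D R j)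
        at-unique zero    = []
        at-unique (suc j) = Unique.map⁺ ∷-injectiveʳ (forms-unique k R j ascending)
        continuing-unique : Unique (continuing k s₀ s₁ D R j)
        continuing-unique = Unique.map⁺ (extendFirst-injective s₀ D) (forms-unique k (s₁ ∷ R) j ascending₁)
        at∩continuing : Disjoint (closingAt k s₀ s₁ D R j) (continuing k s₀ s₁ D R j)
        at∩continuing (F∈a , F∈c) with closingAt-shape k j F∈a | continuing-shape k split j F∈c
        ... | _ , refl | _ , _ , _ , e with ∷-injectiveʳ (++-cancelˡ D _ _ (first-cycles-≡ e))
        ...   | ()
        before∩rest : Disjoint (closingBefore k s₀ s₁ D R j) (closingAt k s₀ s₁ D R j ++ continuing k s₀ s₁ D R j)
        before∩rest (F∈b , F∈r) with closingBefore-shape k split j F∈b | ∈-++⁻ (closingAt k s₀ s₁ D R j) F∈r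
        ... | _ , _ , refl | inj₁ F∈a with closingAt-shape k j F∈a
        ...   | _ , e with ++-identityʳ-unique D (first-cycles-≡ e)
        ...     | ()
        before∩rest (F∈b , F∈r) | _ , _ , refl | inj₂ F∈c with continuing-shape k split j F∈c
        ...   | _ , _ , _ , e with ++-identityʳ-unique D (first-cycles-≡ e)
        ...     | ()

  -- The recurrence

  binomialSum-cong : ∀ n {g h} → (∀ d r → d + r ≡ n → g d r ≡ h d r) → binomialSum n g ≡ binomialSum n h
  binomialSum-cong zero    g≡h = g≡h 0 0 refl
  binomialSum-cong (suc n) g≡h = cong₂ _+_
    (binomialSum-cong n λ d r e → g≡h (suc d) r (cong suc e))
    (binomialSum-cong n λ d r e → g≡h d (suc r) (trans (+-suc d r) (cong suc e)))

  binomialSum-+ : ∀ n g h → binomialSum n (λ d r → g d r + h d r) ≡ binomialSum n g + binomialSum n h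
  binomialSum-+ zero    g h = refl
  binomialSum-+ (suc n) g h =
    trans (cong₂ _+_ (binomialSum-+ n (λ d r → g (suc d) r) (λ d r → h (suc d) r))
                     (binomialSum-+ n (λ d r → g d (suc r)) (λ d r → h d (suc r))))
          (interchange (binomialSum n (λ d r → g (suc d) r)) (binomialSum n (λ d r → h (suc d) r))
                       (binomialSum n (λ d r → g d (suc r))) (binomialSum n (λ d r → h d (suc r))))

  binomialSum-ifPos : ∀ n g → binomialSum n g ≡ binomialSum n (λ d r → ifPos d (g d r)) + g 0 n
  binomialSum-ifPos zero    g = refl
  binomialSum-ifPos (suc n) g = trans (cong (binomialSum n (λ d r → g (suc d) r) +_) (binomialSum-ifPos n (λ d r → g d (suc r))))
                                      (sym (+-assoc (binomialSum n (λ d r → g (suc d) r)) _ (g 0 (suc n))))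

  #forms-fuel : ∀ {k k′} m j → m ≤ k → m ≤ k′ → #forms k m j ≡ #forms k′ m j
  #forms-fuel zero zero _ _ = refl
  #forms-fuel zero (suc j) _ _ = refl
  #forms-fuel (suc zero) j _ _ = refl
  #forms-fuel {suc k} {suc k′} (suc (suc n)) j (s≤s m≤k) (s≤s m≤k′) = binomialSum-cong n λ d r d+r≡n →
    let r<k  = ≤-trans (s≤s (subst (r ≤_) d+r≡n (m≤n+m r d))) m≤k
        r<k′ = ≤-trans (s≤s (subst (r ≤_) d+r≡n (m≤n+m r d))) m≤k′
    in cong₂ _+_ (cong₂ _+_ (cong (ifPos d ∘ ifPos j) (#forms-fuel (suc r) (j ∸ 1) r<k r<k′))
                            (cong (ifPos j) (#forms-fuel r (j ∸ 1) (≤-trans (n≤1+n r) r<k) (≤-trans (n≤1+n r) r<k′))))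
                 (#forms-fuel (suc r) j r<k r<k′)

  eCoeff≡#forms : ∀ n j → eCoeff n j ≡ #forms n n j
  eCoeff≡#forms n j = begin
    eCoeff n j                   ≡⟨ eCoeff≡#avoidingForms n j (forms n (upTo n) j) (forms-unique n (upTo n) j ascending)
                                      (forms-sound n (upTo n) j ascending)
                                      (forms-complete n (upTo n) j ascending (≤-reflexive (length-upTo n))) ⟩
    length (forms n (upTo n) j)  ≡⟨ length-forms n (upTo n) j ⟩
    #forms n (length (upTo n)) j ≡⟨ cong (λ m → #forms n m j) (length-upTo n) ⟩
    #forms n n j                 ∎
    where
      open ≡-Reasoning
      ascending : Ascending (upTo n)
      ascending = AllPairs.applyUpTo⁺₁ id n (λ i<j _ → i<j)

  #forms≡eCoeff : ∀ {k} m j → m ≤ k → #forms k m j ≡ eCoeff m j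
  #forms≡eCoeff m j m≤k = trans (#forms-fuel m j m≤k ≤-refl) (sym (eCoeff≡#forms m j))

  eCoeff-recurrence : ∀ n j → eCoeff (2 + n) j ≡ binomialSum n λ d r →
    ifPos d (ifPos j (eCoeff (suc r) (j ∸ 1))) + ifPos j (eCoeff r (j ∸ 1)) + eCoeff (suc r) j
  eCoeff-recurrence n j = trans (eCoeff≡#forms (2 + n) j) (binomialSum-cong n λ d r d+r≡n →
    let 1+r≤1+n = s≤s (subst (r ≤_) d+r≡n (m≤n+m r d))
    in cong₂ _+_ (cong₂ _+_ (cong (ifPos d ∘ ifPos j) (#forms≡eCoeff (suc r) (j ∸ 1) 1+r≤1+n))
                            (cong (ifPos j) (#forms≡eCoeff r (j ∸ 1) (≤-trans (n≤1+n r) 1+r≤1+n))))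
                 (#forms≡eCoeff (suc r) j 1+r≤1+n))

  eCoeff-recurrence-zero : ∀ n → eCoeff (2 + n) 0 ≡ binomialSum n (λ _ r → eCoeff (suc r) 0)
  eCoeff-recurrence-zero n = trans (eCoeff-recurrence n 0) (binomialSum-cong n λ { zero _ _ → refl ; (suc _) _ _ → refl })

  eCoeff-recurrence-suc : ∀ n j → eCoeff (2 + n) (suc j) ≡
    binomialSum n (λ d r → ifPos d (eCoeff (suc r) j)) + binomialSum n (λ _ r → eCoeff r j)
      + binomialSum n (λ _ r → eCoeff (suc r) (suc j))
  eCoeff-recurrence-suc n j = begin
    eCoeff (2 + n) (suc j)
      ≡⟨ eCoeff-recurrence n (suc j) ⟩
    binomialSum n (λ d r → ifPos d (eCoeff (suc r) j) + eCoeff r j + eCoeff (suc r) (suc j))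
      ≡⟨ binomialSum-+ n _ _ ⟩
    binomialSum n (λ d r → ifPos d (eCoeff (suc r) j) + eCoeff r j) + binomialSum n (λ _ r → eCoeff (suc r) (suc j))
      ≡⟨ cong (_+ binomialSum n (λ _ r → eCoeff (suc r) (suc j))) (binomialSum-+ n _ _) ⟩
    binomialSum n (λ d r → ifPos d (eCoeff (suc r) j)) + binomialSum n (λ _ r → eCoeff r j)
      + binomialSum n (λ _ r → eCoeff (suc r) (suc j)) ∎
    where open ≡-Reasoning

open Counting using (binomialSum; ifPos; binomialSum-ifPos; eCoeff-recurrence-zero; eCoeff-recurrence-suc)

open import Algebra.Bundles using (CommutativeMonoid)
import Data.Integer as ℤ
import Data.Integer.Properties as ℤ
open import Data.Nat as ℕ using (ℕ; zero; suc; _∸_; _!)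
import Data.Nat.Properties as ℕ
open import Data.Nat.Properties using (_!≢0)
import Data.Nat.Coprimality as Coprime
open import Data.Rational using (ℚ; mkℚ; _+_; _*_; _-_; -_; 0ℚ; 1ℚ; _/_)
open import Data.Rational.Properties
  using (normalize-coprime; /-cong; *-inverseʳ; *-identityˡ; *-identityʳ; *-assoc; *-distribˡ-+; *-distribʳ-+; *-zeroˡ;
         +-identityˡ; +-identityʳ; +-assoc; +-0-commutativeMonoid)
open import Algebra.Properties.CommutativeSemigroup (CommutativeMonoid.commutativeSemigroup +-0-commutativeMonoid)
  using (interchange)
open import Data.Rational.Solver using (module +-*-Solver)
open import Relation.Binary.PropositionalEquality
open +-*-Solver using (solve; _:+_; _:*_; :-_; _:=_)
open ≡-Reasoning

-- Exponential generating functions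

fromℕℚ≡mkℚ : ∀ k → fromℕℚ k ≡ mkℚ (ℤ.+ k) 0 (Coprime.sym (Coprime.1-coprimeTo k))
fromℕℚ≡mkℚ k = normalize-coprime (Coprime.sym (Coprime.1-coprimeTo k))

fromℕℚ-+ : ∀ a b → fromℕℚ (a ℕ.+ b) ≡ fromℕℚ a + fromℕℚ b
fromℕℚ-+ a b rewrite fromℕℚ≡mkℚ a | fromℕℚ≡mkℚ b =
  /-cong (sym (cong₂ ℤ._+_ (ℤ.*-identityʳ (ℤ.+ a)) (ℤ.*-identityʳ (ℤ.+ b)))) refl

fromℕℚ-* : ∀ a b → fromℕℚ (a ℕ.* b) ≡ fromℕℚ a * fromℕℚ b
fromℕℚ-* a b rewrite fromℕℚ≡mkℚ a | fromℕℚ≡mkℚ b = /-cong (ℤ.pos-* a b) refl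

fromℕℚ-suc-inverse : ∀ d → fromℕℚ (suc d) * (ℤ.+ 1 / suc d) ≡ 1ℚ
fromℕℚ-suc-inverse d rewrite fromℕℚ≡mkℚ (suc d) | normalize-coprime (Coprime.1-coprimeTo (suc d)) =
  *-inverseʳ (mkℚ (ℤ.+ suc d) 0 (Coprime.sym (Coprime.1-coprimeTo (suc d))))

fromℕℚ[n!]*invFact[n]≡1 : ∀ n → fromℕℚ (n !) * invFact n ≡ 1ℚ
fromℕℚ[n!]*invFact[n]≡1 n with n ! | n !≢0
... | suc d | _ = fromℕℚ-suc-inverse d

fromℕℚ-suc*invFact-suc : ∀ m → fromℕℚ (suc m) * invFact (suc m) ≡ invFact m
fromℕℚ-suc*invFact-suc m = begin
  fromℕℚ (suc m) * invFact (suc m)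
    ≡⟨ *-identityʳ _ ⟨
  fromℕℚ (suc m) * invFact (suc m) * 1ℚ
    ≡⟨ cong (fromℕℚ (suc m) * invFact (suc m) *_) (fromℕℚ[n!]*invFact[n]≡1 m) ⟨
  fromℕℚ (suc m) * invFact (suc m) * (fromℕℚ (m !) * invFact m)
    ≡⟨ rearrange (fromℕℚ (suc m)) (invFact (suc m)) (fromℕℚ (m !)) (invFact m) ⟩
  fromℕℚ (suc m) * fromℕℚ (m !) * invFact (suc m) * invFact m
    ≡⟨ cong (λ z → z * invFact (suc m) * invFact m) (fromℕℚ-* (suc m) (m !)) ⟨
  fromℕℚ (suc m !) * invFact (suc m) * invFact m
    ≡⟨ cong (_* invFact m) (fromℕℚ[n!]*invFact[n]≡1 (suc m)) ⟩
  1ℚ * invFact m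
    ≡⟨ *-identityˡ (invFact m) ⟩
  invFact m ∎
  where
    rearrange : ∀ a b c d → a * b * (c * d) ≡ a * c * b * d
    rearrange = solve 4 (λ a b c d → a :* b :* (c :* d) := a :* c :* b :* d) refl

fromℕℚ-suc-cancelˡ : ∀ m {x y} → fromℕℚ (suc m) * x ≡ fromℕℚ (suc m) * y → x ≡ y
fromℕℚ-suc-cancelˡ m {x} {y} e = begin
  x                                                     ≡⟨ undo x ⟩
  fromℕℚ (m !) * invFact (suc m) * (fromℕℚ (suc m) * x) ≡⟨ cong (fromℕℚ (m !) * invFact (suc m) *_) e ⟩
  fromℕℚ (m !) * invFact (suc m) * (fromℕℚ (suc m) * y) ≡⟨ undo y ⟨
  y                                                     ∎
  where
    rearrange : ∀ a b c z → a * (c * b) * z ≡ a * b * (c * z)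
    rearrange = solve 4 (λ a b c z → a :* (c :* b) :* z := a :* b :* (c :* z)) refl
    undo : ∀ z → z ≡ fromℕℚ (m !) * invFact (suc m) * (fromℕℚ (suc m) * z)
    undo z = sym (begin
      fromℕℚ (m !) * invFact (suc m) * (fromℕℚ (suc m) * z) ≡⟨ rearrange (fromℕℚ (m !)) (invFact (suc m)) (fromℕℚ (suc m)) z ⟨
      fromℕℚ (m !) * (fromℕℚ (suc m) * invFact (suc m)) * z ≡⟨ cong (λ w → fromℕℚ (m !) * w * z) (fromℕℚ-suc*invFact-suc m) ⟩
      fromℕℚ (m !) * invFact m * z                          ≡⟨ cong (_* z) (fromℕℚ[n!]*invFact[n]≡1 m) ⟩
      1ℚ * z                                                ≡⟨ *-identityˡ z ⟩
      z                                                     ∎)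

fromℕℚ-suc-shift : ∀ m x → fromℕℚ (suc m) * (x * invFact (suc m)) ≡ x * invFact m
fromℕℚ-suc-shift m x = begin
  fromℕℚ (suc m) * (x * invFact (suc m)) ≡⟨ swap (fromℕℚ (suc m)) x (invFact (suc m)) ⟩
  x * (fromℕℚ (suc m) * invFact (suc m)) ≡⟨ cong (x *_) (fromℕℚ-suc*invFact-suc m) ⟩
  x * invFact m                          ∎
  where
    swap : ∀ p x q → p * (x * q) ≡ x * (p * q)
    swap = solve 3 (λ p x q → p :* (x :* q) := x :* (p :* q)) refl

sumUpTo-cong : ∀ n {f g : ℕ → ℚ} → (∀ a → f a ≡ g a) → sumUpTo n f ≡ sumUpTo n g
sumUpTo-cong zero    f≡g = f≡g 0
sumUpTo-cong (suc n) f≡g = cong₂ _+_ (sumUpTo-cong n f≡g) (f≡g (suc n))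

sumUpTo-+ : ∀ n (f g : ℕ → ℚ) → sumUpTo n (λ a → f a + g a) ≡ sumUpTo n f + sumUpTo n g
sumUpTo-+ zero    f g = refl
sumUpTo-+ (suc n) f g = trans (cong (_+ (f (suc n) + g (suc n))) (sumUpTo-+ n f g))
                              (interchange (sumUpTo n f) (sumUpTo n g) (f (suc n)) (g (suc n)))

sumUpTo-only-0 : ∀ n (f : ℕ → ℚ) → (∀ a → f (suc a) ≡ 0ℚ) → sumUpTo n f ≡ f 0
sumUpTo-only-0 zero    f f≡0 = refl
sumUpTo-only-0 (suc n) f f≡0 = trans (cong₂ _+_ (sumUpTo-only-0 n f f≡0) (f≡0 n)) (+-identityʳ (f 0))

sumUpTo-only-0-1 : ∀ n (f : ℕ → ℚ) → (∀ a → f (suc (suc a)) ≡ 0ℚ) → sumUpTo (suc n) f ≡ f 0 + f 1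
sumUpTo-only-0-1 zero    f f≡0 = refl
sumUpTo-only-0-1 (suc n) f f≡0 = trans (cong₂ _+_ (sumUpTo-only-0-1 n f f≡0) (f≡0 n)) (+-identityʳ (f 0 + f 1))

sumUpTo-0ℚ : ∀ n → sumUpTo n (λ _ → 0ℚ) ≡ 0ℚ
sumUpTo-0ℚ n = sumUpTo-only-0 n (λ _ → 0ℚ) (λ _ → refl)

sumUpTo-suc : ∀ n (f : ℕ → ℚ) → sumUpTo (suc n) f ≡ f 0 + sumUpTo n (λ a → f (suc a))
sumUpTo-suc zero    f = refl
sumUpTo-suc (suc n) f = trans (cong (_+ f (suc (suc n))) (sumUpTo-suc n f)) (+-assoc (f 0) _ _)

antidiagonal : ℕ → (ℕ → ℕ → ℚ) → ℚ
antidiagonal zero    φ = φ 0 0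
antidiagonal (suc n) φ = φ 0 (suc n) + antidiagonal n (λ a b → φ (suc a) b)

antidiagonal-cong : ∀ n {φ ψ} → (∀ a b → a ℕ.+ b ≡ n → φ a b ≡ ψ a b) → antidiagonal n φ ≡ antidiagonal n ψ
antidiagonal-cong zero    φ≡ψ = φ≡ψ 0 0 refl
antidiagonal-cong (suc n) φ≡ψ = cong₂ _+_ (φ≡ψ 0 (suc n) refl) (antidiagonal-cong n (λ a b e → φ≡ψ (suc a) b (cong suc e)))

antidiagonal-+ : ∀ n (φ ψ : ℕ → ℕ → ℚ) → antidiagonal n (λ a b → φ a b + ψ a b) ≡ antidiagonal n φ + antidiagonal n ψ
antidiagonal-+ zero    φ ψ = refl
antidiagonal-+ (suc n) φ ψ = trans (cong ((φ 0 (suc n) + ψ 0 (suc n)) +_) (antidiagonal-+ n _ _))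
                                   (interchange (φ 0 (suc n)) (ψ 0 (suc n)) _ _)

antidiagonal-*ˡ : ∀ n c (φ : ℕ → ℕ → ℚ) → antidiagonal n (λ a b → c * φ a b) ≡ c * antidiagonal n φ
antidiagonal-*ˡ zero    c φ = refl
antidiagonal-*ˡ (suc n) c φ = trans (cong (c * φ 0 (suc n) +_) (antidiagonal-*ˡ n c _))
                                    (sym (*-distribˡ-+ c (φ 0 (suc n)) _))

antidiagonal-sucʳ : ∀ n (φ : ℕ → ℕ → ℚ) → antidiagonal (suc n) φ ≡ antidiagonal n (λ a b → φ a (suc b)) + φ (suc n) 0
antidiagonal-sucʳ zero    φ = refl
antidiagonal-sucʳ (suc n) φ = trans (cong (φ 0 (suc (suc n)) +_) (antidiagonal-sucʳ n (λ a b → φ (suc a) b)))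
                                    (sym (+-assoc (φ 0 (suc (suc n))) _ _))

sumUpTo≡antidiagonal : ∀ n (φ : ℕ → ℕ → ℚ) → sumUpTo n (λ a → φ a (n ℕ.∸ a)) ≡ antidiagonal n φ
sumUpTo≡antidiagonal zero    φ = refl
sumUpTo≡antidiagonal (suc n) φ =
  trans (sumUpTo-suc n _) (cong (φ 0 (suc n) +_) (sumUpTo≡antidiagonal n (λ a b → φ (suc a) b)))

invFact-predˡ invFact-predʳ : ℕ → ℕ → ℚ
invFact-predˡ zero    b = 0ℚ
invFact-predˡ (suc a) b = invFact a * invFact b
invFact-predʳ a zero    = 0ℚ
invFact-predʳ a (suc b) = invFact a * invFact b

pascal : ∀ a b → fromℕℚ (a ℕ.+ b) * (invFact a * invFact b) ≡ invFact-predˡ a b + invFact-predʳ a b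
pascal zero    zero    = refl
pascal zero    (suc b) = begin
  fromℕℚ (suc b) * (1ℚ * invFact (suc b)) ≡⟨ cong (fromℕℚ (suc b) *_) (*-identityˡ _) ⟩
  fromℕℚ (suc b) * invFact (suc b)        ≡⟨ fromℕℚ-suc*invFact-suc b ⟩
  invFact b                               ≡⟨ *-identityˡ _ ⟨
  1ℚ * invFact b                          ≡⟨ +-identityˡ _ ⟨
  0ℚ + 1ℚ * invFact b                     ∎
pascal (suc a) zero    = begin
  fromℕℚ (suc a ℕ.+ 0) * (invFact (suc a) * 1ℚ) ≡⟨ cong₂ (λ k x → fromℕℚ k * x) (ℕ.+-identityʳ (suc a)) (*-identityʳ _) ⟩
  fromℕℚ (suc a) * invFact (suc a)              ≡⟨ fromℕℚ-suc*invFact-suc a ⟩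
  invFact a                                     ≡⟨ *-identityʳ _ ⟨
  invFact a * 1ℚ                                ≡⟨ +-identityʳ _ ⟨
  invFact a * 1ℚ + 0ℚ                           ∎
pascal (suc a) (suc b) = begin
  fromℕℚ (suc a ℕ.+ suc b) * (invFact (suc a) * invFact (suc b))
    ≡⟨ cong (_* (invFact (suc a) * invFact (suc b))) (fromℕℚ-+ (suc a) (suc b)) ⟩
  (fromℕℚ (suc a) + fromℕℚ (suc b)) * (invFact (suc a) * invFact (suc b))
    ≡⟨ expand (fromℕℚ (suc a)) (fromℕℚ (suc b)) (invFact (suc a)) (invFact (suc b)) ⟩
  fromℕℚ (suc a) * invFact (suc a) * invFact (suc b) + invFact (suc a) * (fromℕℚ (suc b) * invFact (suc b))
    ≡⟨ cong₂ (λ x y → x * invFact (suc b) + invFact (suc a) * y) (fromℕℚ-suc*invFact-suc a) (fromℕℚ-suc*invFact-suc b) ⟩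
  invFact a * invFact (suc b) + invFact (suc a) * invFact b ∎
  where
    expand : ∀ p q x y → (p + q) * (x * y) ≡ p * x * y + x * (q * y)
    expand = solve 4 (λ p q x y → (p :+ q) :* (x :* y) := p :* x :* y :+ x :* (q :* y)) refl

antidiagonal-predˡ : ∀ n (φ : ℕ → ℕ → ℚ) → antidiagonal (suc n) (λ a b → invFact-predˡ a b * φ a b) ≡
                             antidiagonal n (λ a b → invFact a * invFact b * φ (suc a) b)
antidiagonal-predˡ n φ = begin
  0ℚ * φ 0 (suc n) + rest ≡⟨ cong (_+ rest) (*-zeroˡ (φ 0 (suc n))) ⟩
  0ℚ + rest               ≡⟨ +-identityˡ rest ⟩
  rest                    ∎
  where
    rest : ℚ
    rest = antidiagonal n (λ a b → invFact a * invFact b * φ (suc a) b)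

antidiagonal-predʳ : ∀ n (φ : ℕ → ℕ → ℚ) → antidiagonal (suc n) (λ a b → invFact-predʳ a b * φ a b) ≡
                             antidiagonal n (λ a b → invFact a * invFact b * φ a (suc b))
antidiagonal-predʳ n φ = begin
  antidiagonal (suc n) (λ a b → invFact-predʳ a b * φ a b) ≡⟨ antidiagonal-sucʳ n (λ a b → invFact-predʳ a b * φ a b) ⟩
  rest + 0ℚ * φ (suc n) 0                                  ≡⟨ cong (rest +_) (*-zeroˡ (φ (suc n) 0)) ⟩
  rest + 0ℚ                                                ≡⟨ +-identityʳ rest ⟩
  rest                                                     ∎
  where
    rest : ℚ
    rest = antidiagonal n (λ a b → invFact a * invFact b * φ a (suc b))

-- Multiplying by n + 1 = a + b and applying pascal splits the sum into the two halves of
-- binomialSum (n + 1) h.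
exponential-convolution : ∀ n (h : ℕ → ℕ → ℕ) →
  antidiagonal n (λ a b → invFact a * invFact b * fromℕℚ (h a b)) ≡ fromℕℚ (binomialSum n h) * invFact n
exponential-convolution zero    h = trans (*-identityˡ (fromℕℚ (h 0 0))) (sym (*-identityʳ (fromℕℚ (h 0 0))))
exponential-convolution (suc n) h = fromℕℚ-suc-cancelˡ n (begin
  fromℕℚ (suc n) * antidiagonal (suc n) (λ a b → invFact a * invFact b * H a b)
    ≡⟨ antidiagonal-*ˡ (suc n) (fromℕℚ (suc n)) (λ a b → invFact a * invFact b * H a b) ⟨
  antidiagonal (suc n) (λ a b → fromℕℚ (suc n) * (invFact a * invFact b * H a b))
    ≡⟨ antidiagonal-cong (suc n) weigh ⟩
  antidiagonal (suc n) (λ a b → invFact-predˡ a b * H a b + invFact-predʳ a b * H a b)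
    ≡⟨ antidiagonal-+ (suc n) (λ a b → invFact-predˡ a b * H a b) (λ a b → invFact-predʳ a b * H a b) ⟩
  antidiagonal (suc n) (λ a b → invFact-predˡ a b * H a b) + antidiagonal (suc n) (λ a b → invFact-predʳ a b * H a b)
    ≡⟨ cong₂ _+_ (antidiagonal-predˡ n H) (antidiagonal-predʳ n H) ⟩
  antidiagonal n (λ a b → invFact a * invFact b * H (suc a) b) + antidiagonal n (λ a b → invFact a * invFact b * H a (suc b))
    ≡⟨ cong₂ _+_ (exponential-convolution n _) (exponential-convolution n _) ⟩
  fromℕℚ (binomialSum n hˡ) * invFact n + fromℕℚ (binomialSum n hʳ) * invFact n
    ≡⟨ *-distribʳ-+ (invFact n) (fromℕℚ (binomialSum n hˡ)) (fromℕℚ (binomialSum n hʳ)) ⟨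
  (fromℕℚ (binomialSum n hˡ) + fromℕℚ (binomialSum n hʳ)) * invFact n
    ≡⟨ cong (_* invFact n) (fromℕℚ-+ (binomialSum n hˡ) (binomialSum n hʳ)) ⟨
  fromℕℚ (binomialSum (suc n) h) * invFact n
    ≡⟨ cong (fromℕℚ (binomialSum (suc n) h) *_) (fromℕℚ-suc*invFact-suc n) ⟨
  fromℕℚ (binomialSum (suc n) h) * (fromℕℚ (suc n) * invFact (suc n))
    ≡⟨ x*[y*z]≡y*[x*z] (fromℕℚ (binomialSum (suc n) h)) (fromℕℚ (suc n)) (invFact (suc n)) ⟩
  fromℕℚ (suc n) * (fromℕℚ (binomialSum (suc n) h) * invFact (suc n)) ∎)
  where
    H : ℕ → ℕ → ℚ
    H a b = fromℕℚ (h a b)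
    hˡ hʳ : ℕ → ℕ → ℕ
    hˡ d r = h (suc d) r
    hʳ d r = h d (suc r)
    x*[y*z]≡y*[x*z] : ∀ x y z → x * (y * z) ≡ y * (x * z)
    x*[y*z]≡y*[x*z] = solve 3 (λ x y z → x :* (y :* z) := y :* (x :* z)) refl
    weigh : ∀ a b → a ℕ.+ b ≡ suc n →
            fromℕℚ (suc n) * (invFact a * invFact b * H a b) ≡ invFact-predˡ a b * H a b + invFact-predʳ a b * H a b
    weigh a b a+b≡1+n = begin
      fromℕℚ (suc n) * (invFact a * invFact b * H a b)   ≡⟨ cong (λ k → fromℕℚ k * (invFact a * invFact b * H a b)) a+b≡1+n ⟨
      fromℕℚ (a ℕ.+ b) * (invFact a * invFact b * H a b) ≡⟨ *-assoc (fromℕℚ (a ℕ.+ b)) (invFact a * invFact b) (H a b) ⟨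
      fromℕℚ (a ℕ.+ b) * (invFact a * invFact b) * H a b ≡⟨ cong (_* H a b) (pascal a b) ⟩
      (invFact-predˡ a b + invFact-predʳ a b) * H a b    ≡⟨ *-distribʳ-+ (H a b) (invFact-predˡ a b) (invFact-predʳ a b) ⟩
      invFact-predˡ a b * H a b + invFact-predʳ a b * H a b ∎

expX-convolution : ∀ n (g : ℕ → ℕ) →
  sumUpTo n (λ a → invFact a * (fromℕℚ (g (n ∸ a)) * invFact (n ∸ a))) ≡ fromℕℚ (binomialSum n (λ _ r → g r)) * invFact n
expX-convolution n g = begin
  sumUpTo n (λ a → invFact a * (fromℕℚ (g (n ∸ a)) * invFact (n ∸ a)))
    ≡⟨ sumUpTo≡antidiagonal n (λ a b → invFact a * (fromℕℚ (g b) * invFact b)) ⟩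
  antidiagonal n (λ a b → invFact a * (fromℕℚ (g b) * invFact b))
    ≡⟨ antidiagonal-cong n (λ a b _ → rearrange (invFact a) (fromℕℚ (g b)) (invFact b)) ⟩
  antidiagonal n (λ a b → invFact a * invFact b * fromℕℚ (g b))
    ≡⟨ exponential-convolution n (λ _ r → g r) ⟩
  fromℕℚ (binomialSum n (λ _ r → g r)) * invFact n ∎
  where
    rearrange : ∀ x y z → x * (y * z) ≡ x * z * y
    rearrange = solve 3 (λ x y z → x :* (y :* z) := x :* z :* y) refl

expX-convolution-cong : ∀ (G : ℕ → ℚ) (g : ℕ → ℕ) → (∀ m → G m ≡ fromℕℚ (g m) * invFact m) →
                        ∀ n → sumUpTo n (λ a → invFact a * G (n ∸ a)) ≡ fromℕℚ (binomialSum n (λ _ r → g r)) * invFact n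
expX-convolution-cong G g G≡ n = trans (sumUpTo-cong n λ a → cong (invFact a *_) (G≡ (n ∸ a))) (expX-convolution n g)

-- Coefficients of both sides

-- eCoeff 0 0 = 1 counts the empty derangement, so 1 + E generates all the eCoeff m.
oneS⊕E-coeff : ∀ m j → (oneS ⊕ E) m j ≡ fromℕℚ (eCoeff m j) * invFact m
oneS⊕E-coeff zero          zero    = refl
oneS⊕E-coeff zero          (suc j) = refl
oneS⊕E-coeff (suc zero)    j       = refl
oneS⊕E-coeff (suc (suc m)) j       = +-identityˡ _

∂xE-coeff : ∀ m j → ∂x E m j ≡ fromℕℚ (eCoeff (suc m) j) * invFact m
∂xE-coeff zero    j = refl
∂xE-coeff (suc m) j = fromℕℚ-suc-shift (suc m) (fromℕℚ (eCoeff (2 ℕ.+ m) j))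

∂x∂xE-coeff : ∀ n j → ∂x (∂x E) n j ≡ fromℕℚ (eCoeff (2 ℕ.+ n) j) * invFact n
∂x∂xE-coeff n j = trans (cong (fromℕℚ (suc n) *_) (∂xE-coeff (suc n) j)) (fromℕℚ-suc-shift n (fromℕℚ (eCoeff (2 ℕ.+ n) j)))

⊛-coeff-x⁰ : ∀ (F G : Series) → (∀ a b → F (suc a) b ≡ 0ℚ) →
              ∀ a b → (F ⊛ G) a b ≡ sumUpTo b (λ b′ → F 0 b′ * G a (b ∸ b′))
⊛-coeff-x⁰ F G F≡0 a b = sumUpTo-only-0 a _ λ a′ →
  trans (sumUpTo-cong b λ b′ → trans (cong (_* G (a ∸ suc a′) (b ∸ b′)) (F≡0 a′ b′)) (*-zeroˡ (G (a ∸ suc a′) (b ∸ b′))))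
        (sumUpTo-only-0 b (λ _ → 0ℚ) (λ _ → refl))

yeˣ : Series
yeˣ = Y ⊛ expX

[y+1]eˣ-y : Series
[y+1]eˣ-y = ((Y ⊕ oneS) ⊛ expX) ⊖ Y

yeˣ-coeff-0 : ∀ a → yeˣ a 0 ≡ 0ℚ
yeˣ-coeff-0 a = trans (⊛-coeff-x⁰ Y expX (λ _ _ → refl) a 0) (*-zeroˡ (expX a 0))

yeˣ-coeff-suc : ∀ a b → yeˣ a (suc b) ≡ expX a b
yeˣ-coeff-suc a b = begin
  yeˣ a (suc b)                                         ≡⟨ ⊛-coeff-x⁰ Y expX (λ _ _ → refl) a (suc b) ⟩
  sumUpTo (suc b) (λ b′ → Y 0 b′ * expX a (suc b ∸ b′)) ≡⟨ sumUpTo-only-0-1 b _ (λ b′ → *-zeroˡ (expX a (b ∸ suc b′))) ⟩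
  0ℚ * expX a (suc b) + 1ℚ * expX a b                   ≡⟨ cong₂ _+_ (*-zeroˡ (expX a (suc b))) (*-identityˡ (expX a b)) ⟩
  0ℚ + expX a b                                         ≡⟨ +-identityˡ (expX a b) ⟩
  expX a b                                              ∎

[y+1]eˣ-y-coeff-0 : ∀ a → [y+1]eˣ-y a 0 ≡ invFact a
[y+1]eˣ-y-coeff-0 a = begin
  ((Y ⊕ oneS) ⊛ expX) a 0 - Y a 0 ≡⟨ cong₂ _-_ (⊛-coeff-x⁰ (Y ⊕ oneS) expX (λ _ _ → refl) a 0) (Y-x⁰ a) ⟩
  1ℚ * invFact a - 0ℚ             ≡⟨ trans (+-identityʳ _) (*-identityˡ (invFact a)) ⟩
  invFact a                       ∎
  where
    Y-x⁰ : ∀ a → Y a 0 ≡ 0ℚ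
    Y-x⁰ zero    = refl
    Y-x⁰ (suc a) = refl

[y+1]eˣ-coeff-suc : ∀ a b → ((Y ⊕ oneS) ⊛ expX) a (suc b) ≡ expX a b
[y+1]eˣ-coeff-suc a b = begin
  ((Y ⊕ oneS) ⊛ expX) a (suc b)
    ≡⟨ ⊛-coeff-x⁰ (Y ⊕ oneS) expX (λ _ _ → refl) a (suc b) ⟩
  sumUpTo (suc b) (λ b′ → (Y 0 b′ + oneS 0 b′) * expX a (suc b ∸ b′))
    ≡⟨ sumUpTo-only-0-1 b _ (λ b′ → *-zeroˡ (expX a (b ∸ suc b′))) ⟩
  1ℚ * 0ℚ + 1ℚ * expX a b
    ≡⟨ +-identityˡ (1ℚ * expX a b) ⟩
  1ℚ * expX a b
    ≡⟨ *-identityˡ (expX a b) ⟩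
  expX a b ∎

[y+1]eˣ-y-coeff-2+ : ∀ a b → [y+1]eˣ-y a (suc (suc b)) ≡ 0ℚ
[y+1]eˣ-y-coeff-2+ zero    b = cong (_- 0ℚ) ([y+1]eˣ-coeff-suc 0 (suc b))
[y+1]eˣ-y-coeff-2+ (suc a) b = cong (_- 0ℚ) ([y+1]eˣ-coeff-suc (suc a) (suc b))

yeˣ⊛-coeff-0 : ∀ G n → (yeˣ ⊛ G) n 0 ≡ 0ℚ
yeˣ⊛-coeff-0 G n = trans (sumUpTo-cong n λ a → trans (cong (_* G (n ∸ a) 0) (yeˣ-coeff-0 a)) (*-zeroˡ (G (n ∸ a) 0)))
                         (sumUpTo-0ℚ n)

yeˣ⊛-coeff-suc : ∀ G n j → (yeˣ ⊛ G) n (suc j) ≡ sumUpTo n (λ a → invFact a * G (n ∸ a) j)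
yeˣ⊛-coeff-suc G n j = sumUpTo-cong n λ a → begin
  sumUpTo (suc j) (λ b → yeˣ a b * G (n ∸ a) (suc j ∸ b))
    ≡⟨ sumUpTo-only-0-1 j _ (λ b → trans (cong (_* G (n ∸ a) (j ∸ suc b)) (yeˣ-coeff-suc a (suc b)))
                                         (*-zeroˡ (G (n ∸ a) (j ∸ suc b)))) ⟩
  yeˣ a 0 * G (n ∸ a) (suc j) + yeˣ a 1 * G (n ∸ a) j
    ≡⟨ cong₂ _+_ (trans (cong (_* G (n ∸ a) (suc j)) (yeˣ-coeff-0 a)) (*-zeroˡ (G (n ∸ a) (suc j))))
                 (cong (_* G (n ∸ a) j) (yeˣ-coeff-suc a 0)) ⟩
  0ℚ + invFact a * G (n ∸ a) j
    ≡⟨ +-identityˡ _ ⟩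
  invFact a * G (n ∸ a) j ∎

[y+1]eˣ-y⊛-coeff-0 : ∀ G n → ([y+1]eˣ-y ⊛ G) n 0 ≡ sumUpTo n (λ a → invFact a * G (n ∸ a) 0)
[y+1]eˣ-y⊛-coeff-0 G n = sumUpTo-cong n λ a → cong (_* G (n ∸ a) 0) ([y+1]eˣ-y-coeff-0 a)

[y+1]eˣ-y⊛-coeff-suc : ∀ G n j → ([y+1]eˣ-y ⊛ G) n (suc j) ≡
  sumUpTo n (λ a → invFact a * G (n ∸ a) (suc j)) + (sumUpTo n (λ a → invFact a * G (n ∸ a) j) - G n j)
[y+1]eˣ-y⊛-coeff-suc G n j = begin
  sumUpTo n (λ a → sumUpTo (suc j) (λ b → [y+1]eˣ-y a b * G (n ∸ a) (suc j ∸ b)))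
    ≡⟨ sumUpTo-cong n (λ a → trans (sumUpTo-only-0-1 j _ (higher-terms a)) (split-terms a)) ⟩
  sumUpTo n (λ a → invFact a * G (n ∸ a) (suc j) + (invFact a * G (n ∸ a) j + - (Y a 1 * G (n ∸ a) j)))
    ≡⟨ sumUpTo-+ n I·G[1+j] (λ a → I·G[j] a + - Y·G[j] a) ⟩
  sumUpTo n I·G[1+j] + sumUpTo n (λ a → I·G[j] a + - Y·G[j] a)
    ≡⟨ cong (sumUpTo n I·G[1+j] +_) (sumUpTo-+ n I·G[j] (λ a → - Y·G[j] a)) ⟩
  sumUpTo n I·G[1+j] + (sumUpTo n I·G[j] + sumUpTo n (λ a → - Y·G[j] a))
    ≡⟨ cong (λ s → sumUpTo n I·G[1+j] + (sumUpTo n I·G[j] + s))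
            (trans (sumUpTo-only-0 n _ (λ a → cong -_ (*-zeroˡ (G (n ∸ suc a) j)))) (cong -_ (*-identityˡ (G n j)))) ⟩
  sumUpTo n I·G[1+j] + (sumUpTo n I·G[j] - G n j) ∎
  where
    I·G[1+j] I·G[j] Y·G[j] : ℕ → ℚ
    I·G[1+j] a = invFact a * G (n ∸ a) (suc j)
    I·G[j]   a = invFact a * G (n ∸ a) j
    Y·G[j]   a = Y a 1 * G (n ∸ a) j
    distribute : ∀ i y u v → i * u + (i - y) * v ≡ i * u + (i * v + - (y * v))
    distribute = solve 4 (λ i y u v → i :* u :+ (i :+ :- y) :* v := i :* u :+ (i :* v :+ :- (y :* v))) refl
    higher-terms : ∀ a b → [y+1]eˣ-y a (suc (suc b)) * G (n ∸ a) (j ∸ suc b) ≡ 0ℚ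
    higher-terms a b = trans (cong (_* G (n ∸ a) (j ∸ suc b)) ([y+1]eˣ-y-coeff-2+ a b)) (*-zeroˡ (G (n ∸ a) (j ∸ suc b)))
    split-terms : ∀ a → [y+1]eˣ-y a 0 * G (n ∸ a) (suc j) + [y+1]eˣ-y a 1 * G (n ∸ a) j ≡
                        invFact a * G (n ∸ a) (suc j) + (invFact a * G (n ∸ a) j + - (Y a 1 * G (n ∸ a) j))
    split-terms a = trans (cong₂ (λ k l → k * G (n ∸ a) (suc j) + l * G (n ∸ a) j)
                                 ([y+1]eˣ-y-coeff-0 a) (cong (_- Y a 1) ([y+1]eˣ-coeff-suc a 0)))
                          (distribute (invFact a) (Y a 1) (G (n ∸ a) (suc j)) (G (n ∸ a) j))

rhs-coeff-0 : ∀ n → (yeˣ ⊛ (oneS ⊕ E) ⊕ [y+1]eˣ-y ⊛ ∂x E) n 0 ≡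
                    fromℕℚ (binomialSum n (λ _ r → eCoeff (suc r) 0)) * invFact n
rhs-coeff-0 n = begin
  (yeˣ ⊛ (oneS ⊕ E)) n 0 + ([y+1]eˣ-y ⊛ ∂x E) n 0
    ≡⟨ cong₂ _+_ (yeˣ⊛-coeff-0 (oneS ⊕ E) n) ([y+1]eˣ-y⊛-coeff-0 (∂x E) n) ⟩
  0ℚ + sumUpTo n (λ a → invFact a * ∂x E (n ∸ a) 0)
    ≡⟨ +-identityˡ _ ⟩
  sumUpTo n (λ a → invFact a * ∂x E (n ∸ a) 0)
    ≡⟨ expX-convolution-cong (λ m → ∂x E m 0) (λ r → eCoeff (suc r) 0) (λ m → ∂xE-coeff m 0) n ⟩
  fromℕℚ (binomialSum n (λ _ r → eCoeff (suc r) 0)) * invFact n ∎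

rhs-coeff-suc : ∀ n j → (yeˣ ⊛ (oneS ⊕ E) ⊕ [y+1]eˣ-y ⊛ ∂x E) n (suc j) ≡
  fromℕℚ (binomialSum n (λ d r → ifPos d (eCoeff (suc r) j)) ℕ.+ binomialSum n (λ _ r → eCoeff r j)
            ℕ.+ binomialSum n (λ _ r → eCoeff (suc r) (suc j))) * invFact n
rhs-coeff-suc n j = begin
  (yeˣ ⊛ (oneS ⊕ E)) n (suc j) + ([y+1]eˣ-y ⊛ ∂x E) n (suc j)
    ≡⟨ cong₂ _+_ (yeˣ⊛-coeff-suc (oneS ⊕ E) n j) ([y+1]eˣ-y⊛-coeff-suc (∂x E) n j) ⟩
  sumUpTo n (λ a → invFact a * (oneS ⊕ E) (n ∸ a) j)
    + (sumUpTo n (λ a → invFact a * ∂x E (n ∸ a) (suc j)) + (sumUpTo n (λ a → invFact a * ∂x E (n ∸ a) j) - ∂x E n j))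
    ≡⟨ cong₂ _+_ (expX-convolution-cong (λ m → (oneS ⊕ E) m j) (λ r → eCoeff r j) (λ m → oneS⊕E-coeff m j) n)
         (cong₂ _+_ (expX-convolution-cong (λ m → ∂x E m (suc j)) (λ r → eCoeff (suc r) (suc j)) (λ m → ∂xE-coeff m (suc j)) n)
                    (cong₂ _-_ (expX-convolution-cong (λ m → ∂x E m j) (λ r → eCoeff (suc r) j) (λ m → ∂xE-coeff m j) n)
                               (∂xE-coeff n j))) ⟩
  ℚ[ Q ] + (ℚ[ R ] + (ℚ[ binomialSum n (λ _ r → eCoeff (suc r) j) ] - ℚ[ s ]))
    ≡⟨ cong (λ t → ℚ[ Q ] + (ℚ[ R ] + (ℚ[ t ] - ℚ[ s ]))) (binomialSum-ifPos n (λ _ r → eCoeff (suc r) j)) ⟩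
  ℚ[ Q ] + (ℚ[ R ] + (ℚ[ P ℕ.+ s ] - ℚ[ s ]))
    ≡⟨ cong (λ t → ℚ[ Q ] + (ℚ[ R ] + (t * invFact n - ℚ[ s ]))) (fromℕℚ-+ P s) ⟩
  ℚ[ Q ] + (ℚ[ R ] + ((fromℕℚ P + fromℕℚ s) * invFact n - ℚ[ s ]))
    ≡⟨ regroup (fromℕℚ P) (fromℕℚ Q) (fromℕℚ R) (fromℕℚ s) (invFact n) ⟩
  (fromℕℚ P + fromℕℚ Q + fromℕℚ R) * invFact n
    ≡⟨ cong (_* invFact n) (trans (fromℕℚ-+ (P ℕ.+ Q) R) (cong (_+ fromℕℚ R) (fromℕℚ-+ P Q))) ⟨
  ℚ[ P ℕ.+ Q ℕ.+ R ] ∎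
  where
    P Q R s : ℕ
    P = binomialSum n (λ d r → ifPos d (eCoeff (suc r) j))
    Q = binomialSum n (λ _ r → eCoeff r j)
    R = binomialSum n (λ _ r → eCoeff (suc r) (suc j))
    s = eCoeff (suc n) j
    ℚ[_] : ℕ → ℚ
    ℚ[ k ] = fromℕℚ k * invFact n
    regroup : ∀ p q r s i → q * i + (r * i + ((p + s) * i - s * i)) ≡ (p + q + r) * i
    regroup = solve 5 (λ p q r s i → q :* i :+ (r :* i :+ ((p :+ s) :* i :+ :- (s :* i))) := (p :+ q :+ r) :* i) refl

lemma2p12 : ∀ n j →
    ∂x (∂x E) n j
      ≡ ((Y ⊛ expX) ⊛ (oneS ⊕ E)
         ⊕ (((Y ⊕ oneS) ⊛ expX) ⊖ Y) ⊛ ∂x E) n j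
lemma2p12 n zero = begin
  ∂x (∂x E) n 0                                                  ≡⟨ ∂x∂xE-coeff n 0 ⟩
  fromℕℚ (eCoeff (2 ℕ.+ n) 0) * invFact n                        ≡⟨ cong (λ e → fromℕℚ e * invFact n) (eCoeff-recurrence-zero n) ⟩
  fromℕℚ (binomialSum n (λ _ r → eCoeff (suc r) 0)) * invFact n  ≡⟨ rhs-coeff-0 n ⟨
  (yeˣ ⊛ (oneS ⊕ E) ⊕ [y+1]eˣ-y ⊛ ∂x E) n 0                      ∎
lemma2p12 n (suc j) = begin
  ∂x (∂x E) n (suc j)                                            ≡⟨ ∂x∂xE-coeff n (suc j) ⟩
  fromℕℚ (eCoeff (2 ℕ.+ n) (suc j)) * invFact n                  ≡⟨ cong (λ e → fromℕℚ e * invFact n) (eCoeff-recurrence-suc n j) ⟩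
  _                                                              ≡⟨ rhs-coeff-suc n j ⟨
  (yeˣ ⊛ (oneS ⊕ E) ⊕ [y+1]eˣ-y ⊛ ∂x E) n (suc j)                ∎
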